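{- Let $s$ be a graphical sequence and $\xi$ an integer-valued graph parameter. If $\xi$ is stable under 2-switch, then $\xi$ has the interval property on $\mathcal{G}(s)$ and on $\mathcal{F}(s)$.
   Context: Graphs are finite, simple, undirected and labeled. For a graphical sequence $s=(d_1,\dots,d_n)$, $\mathcal{G}(s)$ is the set of graphs with vertex set $[n]$ in which vertex $i$ has degree $d_i$, and $\mathcal{F}(s)$ the set of forests in $\mathcal{G}(s)$. For $a,b,c,d$, the 2-switch $\tau=\binom{a\ b}{c\ d}$ maps a graph $G$ to $G-ab-cd+ac+bd$ if $ab,cd\in E(G)$, $\{a,b\}\cap\{c,d\}=\varnothing$ and $ac,bd\notin E(G)$, and to $G$ otherwise. A graph parameter $\xi$ is stable under 2-switch if $|\xi(\tau(G))-\xi(G)|\le 1$ for every graph $G$ and every 2-switch $\tau$. A parameter $\xi$ defined on a collection $\mathcal{X}$ of graphs has the interval property on $\mathcal{X}$ if $\xi(\mathcal{X})=I\cap\mathbb{Z}$ for some interval $I\subset\mathbb{R}$. -}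

module Defs where

open import Data.Nat using (ℕ; zero; suc; _≥_)
open import Data.Integer as ℤ using (ℤ; ∣_∣)
open import Data.Bool using (Bool; true; false)
open import Data.Fin using (Fin)
open import Data.Vec using (Vec; []; _∷_; lookup; tabulate)
open import Data.List using (List; []; _∷_; length)
open import Data.List.Relation.Unary.Unique.Propositional using (Unique)
open import Data.Product using (Σ; _×_; ∃; ∃-syntax; _,_)
open import Data.Sum using (_⊎_)
open import Relation.Nullary using (¬_)
open import Data.Unit using (⊤)
open import Data.Empty using (⊥)
open import Relation.Binary.PropositionalEquality using (_≡_; _≢_)

-- The proof fields are irrelevant, so two graphs are equal iff their
-- adjacency matrices are equal.
record Graph (n : ℕ) : Set where
  constructor mkGraph
  field
    adj     : Vec (Vec Bool n) n
    .sym    : ∀ i j → lookup (lookup adj i) j ≡ lookup (lookup adj j) i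
    .irrefl : ∀ i → lookup (lookup adj i) i ≡ false

open Graph public

Adj : ∀ {n} → Graph n → Fin n → Fin n → Bool
Adj G i j = lookup (lookup (adj G) i) j

_~[_]_ : ∀ {n} → Fin n → Graph n → Fin n → Set
i ~[ G ] j = Adj G i j ≡ true

countTrue : ∀ {m} → Vec Bool m → ℕ
countTrue []          = 0
countTrue (true ∷ v)  = suc (countTrue v)
countTrue (false ∷ v) = countTrue v

degree : ∀ {n} → Graph n → Fin n → ℕ
degree G i = countTrue (lookup (adj G) i)

degSeq : ∀ {n} → Graph n → Vec ℕ n
degSeq G = tabulate (degree G)

InG : ∀ {n} → Vec ℕ n → Graph n → Set
InG s G = degSeq G ≡ s

Graphical : ∀ {n} → Vec ℕ n → Set
Graphical {n} s = ∃[ G ] InG s G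

Path : ∀ {n} → Graph n → List (Fin n) → Set
Path G []           = ⊤
Path G (x ∷ [])     = ⊤
Path G (x ∷ y ∷ vs) = (x ~[ G ] y) × Path G (y ∷ vs)

last : ∀ {n} → Fin n → List (Fin n) → Fin n
last x []       = x
last x (y ∷ ys) = last y ys

IsCycle : ∀ {n} → Graph n → List (Fin n) → Set
IsCycle G []       = ⊥
IsCycle G (x ∷ vs) =
  (length (x ∷ vs) ≥ 3) × Unique (x ∷ vs) × Path G (x ∷ vs) × (last x vs ~[ G ] x)

IsForest : ∀ {n} → Graph n → Set
IsForest {n} G = ¬ (∃[ vs ] IsCycle G vs)

InF : ∀ {n} → Vec ℕ n → Graph n → Set
InF s G = InG s G × IsForest G

SwitchCond : ∀ {n} → Graph n → Fin n → Fin n → Fin n → Fin n → Set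
SwitchCond G a b c d =
  (a ~[ G ] b) × (c ~[ G ] d) ×
  (a ≢ c) × (a ≢ d) × (b ≢ c) × (b ≢ d) ×
  (Adj G a c ≡ false) × (Adj G b d ≡ false)

SamePair : ∀ {n} → Fin n → Fin n → Fin n → Fin n → Set
SamePair x y u v = (x ≡ u × y ≡ v) ⊎ (x ≡ v × y ≡ u)

-- Adjacency of G - ab - cd + ac + bd, pair by pair.
SwitchedAdj : ∀ {n} → Graph n → Fin n → Fin n → Fin n → Fin n →
              Fin n → Fin n → Bool → Set
SwitchedAdj G a b c d x y e =
  ((SamePair x y a b ⊎ SamePair x y c d) → e ≡ false) ×
  ((SamePair x y a c ⊎ SamePair x y b d) → e ≡ true) ×
  (¬ (SamePair x y a b ⊎ SamePair x y c d ⊎ SamePair x y a c ⊎ SamePair x y b d)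
     → e ≡ Adj G x y)

TwoSwitch : ∀ {n} → Graph n → Fin n → Fin n → Fin n → Fin n → Graph n → Set
TwoSwitch G a b c d H =
  (SwitchCond G a b c d × (∀ x y → SwitchedAdj G a b c d x y (Adj H x y)))
  ⊎ (¬ SwitchCond G a b c d × H ≡ G)

GraphParameter : Set
GraphParameter = ∀ {n} → Graph n → ℤ

StableUnder2Switch : GraphParameter → Set
StableUnder2Switch ξ =
  ∀ {n} (G H : Graph n) (a b c d : Fin n) →
  TwoSwitch G a b c d H → ∣ ξ H ℤ.- ξ G ∣ Data.Nat.≤ 1

-- Interval property of ξ on the collection 𝒳 (a predicate on graphs of
-- order n): ξ(𝒳) = I ∩ ℤ for an interval I, i.e. the image ξ(𝒳) ⊆ ℤ is
-- convex in ℤ: every integer between two attained values is attained.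
IntervalProperty : GraphParameter → ∀ {n} → (Graph n → Set) → Set
IntervalProperty ξ {n} 𝒳 =
  ∀ (G H : Graph n) → 𝒳 G → 𝒳 H → ∀ (z : ℤ) →
  ξ G ℤ.≤ z → z ℤ.≤ ξ H → ∃[ K ] (𝒳 K × ξ K ≡ z)

-- A parameter that changes by at most one along every 2-switch takes all intermediate values along any
-- chain of 2-switches, so it suffices to join any two graphs of 𝒢(s), resp. ℱ(s), by such a chain inside
-- the class. This goes by induction on the number of non-isolated vertices: pick a vertex w, give it the
-- same neighbourhood in both graphs by 2-switches, remove the edges at w, connect the two smaller graphs,
-- and put the edges at w back. For general graphs the neighbourhoods are matched one edge at a time; for
-- forests w is chosen to be a leaf with the same neighbour, so that re-attaching it keeps the graphs acyclic.
module Submission where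

open import Defs hiding (sym)

open import Data.Bool using (Bool; true; false; if_then_else_; _xor_)
open import Data.Bool.Properties using (xor-comm; not-¬; ¬-not) renaming (_≟_ to _≟ᵇ_)
open import Data.Empty using (⊥; ⊥-elim)
open import Data.Fin using (Fin; zero; suc)
open import Data.Fin.Properties using (_≟_; suc-injective; any?; all?; ¬∀⟶∃¬; pigeonhole)
open import Data.Integer as ℤ using (ℤ; ∣_∣)
import Data.Integer.Properties as ℤ
open import Data.List as List using (List; []; _∷_; length)
open import Data.List.Membership.Propositional using (_∈_)
open import Data.List.Membership.Propositional.Properties using (∈-lookup)
open import Data.List.Relation.Unary.All as All using (All; []; _∷_)
open import Data.List.Relation.Unary.All.Properties using (¬Any⇒All¬)
open import Data.List.Relation.Unary.AllPairs using ([]; _∷_)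
open import Data.List.Relation.Unary.Any using (here; there)
open import Data.List.Relation.Unary.Unique.Propositional using (Unique)
open import Data.Nat using (ℕ; zero; suc; pred; _+_; _≤_; _<_; z≤n; s≤s; _≤?_) renaming (_≟_ to _≟ℕ_)
open import Data.Nat.Properties
  using (≤-refl; ≤-trans; ≤-pred; ≤-total; n≤1+n; n<1+n; n≤0⇒n≡0; <⇒≱; ≰⇒>; +-suc;
         +-cancelˡ-≡; +-cancelˡ-≤; m<m+n; module ≤-Reasoning)
open import Data.Product using (Σ; ∃; ∃₂; ∃-syntax; _×_; _,_; proj₁; proj₂; map₂)
open import Data.Sum using (_⊎_; inj₁; inj₂; [_,_])
import Data.Sum as Sum
open import Data.Unit using (⊤; tt)
open import Data.Vec using (Vec; []; _∷_; lookup; tabulate)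
open import Data.Vec.Properties using (lookup∘tabulate; tabulate∘lookup; tabulate-cong)
open import Function using (_∘_; mk⇔)
open import Relation.Nullary using (¬_; Dec; yes; no; does; contradiction)
open import Relation.Nullary.Decidable
  using (_×-dec_; _⊎-dec_; ¬?; recompute; dec-true; dec-false; does-⇔; decidable-stable)
open import Relation.Binary.PropositionalEquality hiding ([_])

private
  variable
    n : ℕ

indicator : Bool → ℕ
indicator true  = 1
indicator false = 0

count : (Fin n → Bool) → ℕ
count {zero}  f = 0
count {suc n} f = indicator (f zero) + count (f ∘ suc)

countTrue≡count : ∀ {m} (v : Vec Bool m) → countTrue v ≡ count (lookup v)
countTrue≡count []          = refl
countTrue≡count (true ∷ v)  = cong suc (countTrue≡count v)
countTrue≡count (false ∷ v) = countTrue≡count v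

count-cong : {f g : Fin n → Bool} → (∀ i → f i ≡ g i) → count f ≡ count g
count-cong {zero}  f≗g = refl
count-cong {suc n} f≗g = cong₂ _+_ (cong indicator (f≗g zero)) (count-cong (f≗g ∘ suc))

count≤n : (f : Fin n → Bool) → count f ≤ n
count≤n {zero}  f = z≤n
count≤n {suc n} f with f zero
... | true  = s≤s (count≤n (f ∘ suc))
... | false = ≤-trans (count≤n (f ∘ suc)) (n≤1+n n)

count-mono : (f g : Fin n → Bool) → (∀ i → f i ≡ true → g i ≡ true) → count f ≤ count g
count-mono {zero}  f g f⊆g = z≤n
count-mono {suc n} f g f⊆g with f zero in f₀ | g zero in g₀
... | true  | true  = s≤s (count-mono (f ∘ suc) (g ∘ suc) (f⊆g ∘ suc))
... | true  | false with () ← trans (sym g₀) (f⊆g zero f₀)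
... | false | true  = ≤-trans (count-mono (f ∘ suc) (g ∘ suc) (f⊆g ∘ suc)) (n≤1+n _)
... | false | false = count-mono (f ∘ suc) (g ∘ suc) (f⊆g ∘ suc)

unset : (Fin n → Bool) → Fin n → Fin n → Bool
unset f p j = if does (j ≟ p) then false else f j

unset-self : (f : Fin n → Bool) (p : Fin n) → unset f p p ≡ false
unset-self f p rewrite dec-true (p ≟ p) refl = refl

unset-other : (f : Fin n → Bool) {p q : Fin n} → q ≢ p → unset f p q ≡ f q
unset-other f {p} {q} q≢p rewrite dec-false (q ≟ p) q≢p = refl

unset-true : (f : Fin n → Bool) {p q : Fin n} → unset f p q ≡ true → q ≢ p × f q ≡ true
unset-true f {p} {q} fq with q ≟ p
... | no q≢p = q≢p , fq

unset-false : (f : Fin n → Bool) {p q : Fin n} → unset f p q ≡ false → q ≡ p ⊎ f q ≡ false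
unset-false f {p} {q} fq with q ≟ p
... | yes q≡p = inj₁ q≡p
... | no  q≢p = inj₂ fq

count-flip : (f g : Fin n → Bool) (p : Fin n) → f p ≡ true → g p ≡ false →
             (∀ i → i ≢ p → f i ≡ g i) → count f ≡ suc (count g)
count-flip {suc n} f g zero fp gp f≗g rewrite fp | gp =
  cong suc (count-cong (λ i → f≗g (suc i) λ ()))
count-flip {suc n} f g (suc p) fp gp f≗g rewrite f≗g zero (λ ()) =
  trans (cong (indicator (g zero) +_)
               (count-flip (f ∘ suc) (g ∘ suc) p fp gp (λ i i≢p → f≗g (suc i) (i≢p ∘ suc-injective))))
        (+-suc _ _)

count-unset : (f : Fin n → Bool) (p : Fin n) → f p ≡ true → count f ≡ suc (count (unset f p))
count-unset f p fp = count-flip f (unset f p) p fp (unset-self f p) (λ i i≢p → sym (unset-other f i≢p))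

count-unset′ : (f : Fin n → Bool) (p : Fin n) → count f ≡ indicator (f p) + count (unset f p)
count-unset′ f p with f p in fp
... | true  = count-unset f p fp
... | false = count-cong f≗unset
  where
  f≗unset : ∀ i → f i ≡ unset f p i
  f≗unset i with i ≟ p
  ... | yes refl = fp
  ... | no  _    = refl

count-< : (f g : Fin n → Bool) → (∀ i → f i ≡ true → g i ≡ true) →
          (p : Fin n) → f p ≡ false → g p ≡ true → count f < count g
count-< f g f⊆g p fp gp = begin-strict
  count f                 ≤⟨ count-mono f (unset g p) f⊆unset ⟩
  count (unset g p)       <⟨ n<1+n _ ⟩
  suc (count (unset g p)) ≡⟨ count-unset g p gp ⟨
  count g                 ∎
  where
  open ≤-Reasoning
  f⊆unset : ∀ i → f i ≡ true → unset g p i ≡ true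
  f⊆unset i fi with i ≟ p
  ... | yes refl with () ← trans (sym fp) fi
  ... | no  _    = f⊆g i fi

count≡0⇒false : (f : Fin n → Bool) → count f ≡ 0 → ∀ i → f i ≡ false
count≡0⇒false f count≡0 i with f i in fi
... | false = refl
... | true with () ← trans (sym count≡0) (count-unset f i fi)

count-false : (f : Fin n → Bool) → (∀ i → f i ≡ false) → count f ≡ 0
count-false {zero}  f f≗false = refl
count-false {suc n} f f≗false rewrite f≗false zero = count-false (f ∘ suc) (f≗false ∘ suc)

count-<⇒∃ : (f g : Fin n → Bool) → count g < count f → ∃ λ i → f i ≡ true × g i ≡ false
count-<⇒∃ {suc n} f g g<f with f zero in f₀ | g zero in g₀
... | true  | false = zero , f₀ , g₀
... | true  | true  with i , fi , gi ← count-<⇒∃ (f ∘ suc) (g ∘ suc) (≤-pred g<f) = suc i , fi , gi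
... | false | false with i , fi , gi ← count-<⇒∃ (f ∘ suc) (g ∘ suc) g<f = suc i , fi , gi
... | false | true  with i , fi , gi ← count-<⇒∃ (f ∘ suc) (g ∘ suc) (≤-trans (n≤1+n _) g<f) = suc i , fi , gi

count>0⇒∃ : (f : Fin n → Bool) → 0 < count f → ∃ λ i → f i ≡ true
count>0⇒∃ {n} f 0<count = map₂ proj₁ (count-<⇒∃ f none (subst (_< count f) (sym none≡0) 0<count))
  where
  none : Fin n → Bool
  none _ = false
  none≡0 : count none ≡ 0
  none≡0 = count-false none (λ _ → refl)

count≥2⇒∃₂ : (f : Fin n → Bool) → 2 ≤ count f → ∃₂ λ i j → i ≢ j × f i ≡ true × f j ≡ true
count≥2⇒∃₂ f 2≤count with count>0⇒∃ f (≤-trans (s≤s z≤n) 2≤count)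
... | i , fi with count>0⇒∃ (unset f i) (≤-pred (subst (2 ≤_) (count-unset f i fi) 2≤count))
... | j , fj = let j≢i , fj′ = unset-true f fj in i , j , ≢-sym j≢i , fi , fj′

count≡1⇒unique : (f : Fin n → Bool) → count f ≡ 1 → ∀ {i j} → f i ≡ true → f j ≡ true → j ≡ i
count≡1⇒unique f count≡1 {i} {j} fi fj with j ≟ i
... | yes j≡i = j≡i
... | no  j≢i = contradiction (trans (sym (unset-other f j≢i)) (count≡0⇒false (unset f i) unset≡0 j)) (not-¬ fj)
  where
  unset≡0 : count (unset f i) ≡ 0
  unset≡0 = cong pred (trans (sym (count-unset f i fi)) count≡1)

count-exchange : (f g : Fin n → Bool) (p q : Fin n) → f p ≡ false → g p ≡ true → f q ≡ true → g q ≡ false →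
                 q ≢ p → (∀ i → i ≢ p → i ≢ q → f i ≡ g i) → count f ≡ count g
count-exchange f g p q fp gp fq gq q≢p f≗g = begin
  count f                 ≡⟨ count-unset f q fq ⟩
  suc (count (unset f q)) ≡⟨ cong suc (count-cong agree) ⟩
  suc (count (unset g p)) ≡⟨ count-unset g p gp ⟨
  count g                 ∎
  where
  open ≡-Reasoning
  agree : ∀ i → unset f q i ≡ unset g p i
  agree i = by-cases (i ≟ p) (i ≟ q)
    where
    by-cases : Dec (i ≡ p) → Dec (i ≡ q) → unset f q i ≡ unset g p i
    by-cases _          (yes refl) = trans (unset-self f i) (sym (trans (unset-other g q≢p) gq))
    by-cases (yes refl) (no i≢q)   = trans (unset-other f i≢q) (trans fp (sym (unset-self g i)))
    by-cases (no i≢p)   (no i≢q)   = trans (unset-other f i≢q) (trans (f≗g i i≢p i≢q) (sym (unset-other g i≢p)))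

count-balance : (f g : Fin n → Bool) → count f ≡ count g → ∀ {p} → f p ≡ true → g p ≡ false →
                ∃ λ q → f q ≡ false × g q ≡ true
count-balance f g f≡g {p} fp gp with count-<⇒∃ g (unset f p) unset<g
  where
  unset<g : count (unset f p) < count g
  unset<g = subst (count (unset f p) <_) (trans (sym (count-unset f p fp)) f≡g) ≤-refl
... | q , gq , unset-q with unset-false f unset-q
... | inj₁ refl with () ← trans (sym gq) gp
... | inj₂ fq = q , fq , gq

Adj-sym : (G : Graph n) (i j : Fin n) → Adj G i j ≡ Adj G j i
Adj-sym (mkGraph a s _) i j = recompute (lookup (lookup a i) j ≟ᵇ lookup (lookup a j) i) (s i j)

Adj-irrefl : (G : Graph n) (i : Fin n) → Adj G i i ≡ false
Adj-irrefl (mkGraph a _ r) i = recompute (lookup (lookup a i) i ≟ᵇ false) (r i)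

adjacent⇒≢ : (G : Graph n) {i j : Fin n} → i ~[ G ] j → i ≢ j
adjacent⇒≢ G {i} i~j refl = contradiction (Adj-irrefl G i) (not-¬ i~j)

~-sym : (G : Graph n) {i j : Fin n} → i ~[ G ] j → j ~[ G ] i
~-sym G {i} {j} i~j = trans (Adj-sym G j i) i~j

degree≡count : (G : Graph n) (i : Fin n) → degree G i ≡ count (Adj G i)
degree≡count G i = countTrue≡count (lookup (adj G) i)

opaque
  fromAdj : (f : Fin n → Fin n → Bool) → (∀ i j → f i j ≡ f j i) → (∀ i → f i i ≡ false) → Graph n
  fromAdj f f-sym f-irrefl = mkGraph (tabulate (tabulate ∘ f))
    (λ i j → trans (lookup-tabulate i j) (trans (f-sym i j) (sym (lookup-tabulate j i))))
    (λ i → trans (lookup-tabulate i i) (f-irrefl i))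
    where
    lookup-tabulate : ∀ i j → lookup (lookup (tabulate (tabulate ∘ f)) i) j ≡ f i j
    lookup-tabulate i j rewrite lookup∘tabulate (tabulate ∘ f) i = lookup∘tabulate (f i) j

  Adj-fromAdj : (f : Fin n → Fin n → Bool) (f-sym : ∀ i j → f i j ≡ f j i) (f-irrefl : ∀ i → f i i ≡ false) →
                ∀ i j → Adj (fromAdj f f-sym f-irrefl) i j ≡ f i j
  Adj-fromAdj f _ _ i j rewrite lookup∘tabulate (tabulate ∘ f) i = lookup∘tabulate (f i) j

graph-ext : (G H : Graph n) → (∀ i j → Adj G i j ≡ Adj H i j) → G ≡ H
graph-ext G@(mkGraph a _ _) H@(mkGraph b _ _) G≗H = adj-ext (begin
  a                     ≡⟨ tabulate∘lookup a ⟨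
  tabulate (lookup a)   ≡⟨ tabulate-cong row-ext ⟩
  tabulate (lookup b)   ≡⟨ tabulate∘lookup b ⟩
  b                     ∎)
  where
  open ≡-Reasoning
  adj-ext : a ≡ b → G ≡ H
  adj-ext refl = refl
  row-ext : ∀ i → lookup a i ≡ lookup b i
  row-ext i = trans (sym (tabulate∘lookup _)) (trans (tabulate-cong (G≗H i)) (tabulate∘lookup _))

HasDegrees : (Fin n → ℕ) → Graph n → Set
HasDegrees d G = ∀ i → degree G i ≡ d i

degree≡0⇒isolated : (G : Graph n) (i : Fin n) → degree G i ≡ 0 → ∀ j → Adj G i j ≡ false
degree≡0⇒isolated G i deg≡0 = count≡0⇒false (Adj G i) (trans (sym (degree≡count G i)) deg≡0)

degree>0⇒∃ : (G : Graph n) (i : Fin n) → 0 < degree G i → ∃ λ j → i ~[ G ] j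
degree>0⇒∃ G i 0<deg = count>0⇒∃ (Adj G i) (subst (0 <_) (degree≡count G i) 0<deg)

SamePair? : (x y u v : Fin n) → Dec (SamePair x y u v)
SamePair? x y u v = ((x ≟ u) ×-dec (y ≟ v)) ⊎-dec ((x ≟ v) ×-dec (y ≟ u))

SamePair-refl : (u v : Fin n) → SamePair u v u v
SamePair-refl u v = inj₁ (refl , refl)

SamePair-symˡ : {x y u v : Fin n} → SamePair x y u v → SamePair y x u v
SamePair-symˡ (inj₁ (x≡u , y≡v)) = inj₂ (y≡v , x≡u)
SamePair-symˡ (inj₂ (x≡v , y≡u)) = inj₁ (y≡u , x≡v)

SamePair-symʳ : {x y u v : Fin n} → SamePair x y u v → SamePair x y v u
SamePair-symʳ = Sum.swap

SamePair-∉ : {x y u v : Fin n} → SamePair x y u v → x ≢ u → x ≢ v → ⊥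
SamePair-∉ (inj₁ (x≡u , _)) x≢u _   = x≢u x≡u
SamePair-∉ (inj₂ (x≡v , _)) _   x≢v = x≢v x≡v

SamePair-other : {x y u v : Fin n} → SamePair x y u v → x ≡ u → x ≢ v → y ≡ v
SamePair-other (inj₁ (_ , y≡v)) _ _   = y≡v
SamePair-other (inj₂ (x≡v , _)) _ x≢v = ⊥-elim (x≢v x≡v)

module _ (a b c d : Fin n) where

  Removed Added : Fin n → Fin n → Set
  Removed x y = SamePair x y a b ⊎ SamePair x y c d
  Added   x y = SamePair x y a c ⊎ SamePair x y b d

  Removed? : ∀ x y → Dec (Removed x y)
  Removed? x y = SamePair? x y a b ⊎-dec SamePair? x y c d

  Added? : ∀ x y → Dec (Added x y)
  Added? x y = SamePair? x y a c ⊎-dec SamePair? x y b d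

record Switched (G : Graph n) (a b c d : Fin n) (K : Graph n) : Set where
  constructor switched
  field
    adjacency : ∀ x y → SwitchedAdj G a b c d x y (Adj K x y)

SwitchStep : Graph n → Graph n → Set
SwitchStep G K = ∃[ a ] ∃[ b ] ∃[ c ] ∃[ d ] (SwitchCond G a b c d × Switched G a b c d K)

module _ {G K : Graph n} {a b c d : Fin n} (S : Switched G a b c d K) where

  removed-edge : ∀ {x y} → Removed a b c d x y → Adj K x y ≡ false
  removed-edge {x} {y} = proj₁ (Switched.adjacency S x y)

  added-edge : ∀ {x y} → Added a b c d x y → x ~[ K ] y
  added-edge {x} {y} = proj₁ (proj₂ (Switched.adjacency S x y))

  untouched-edge : ∀ {x y} → ¬ SamePair x y a b → ¬ SamePair x y c d → ¬ SamePair x y a c → ¬ SamePair x y b d →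
                   Adj K x y ≡ Adj G x y
  untouched-edge {x} {y} ¬ab ¬cd ¬ac ¬bd = proj₂ (proj₂ (Switched.adjacency S x y)) [ ¬ab , [ ¬cd , [ ¬ac , ¬bd ] ] ]

  switched-edge : ∀ {x y} → x ~[ K ] y → (x ~[ G ] y × ¬ Removed a b c d x y) ⊎ Added a b c d x y
  switched-edge {x} {y} x~y with Removed? a b c d x y | Added? a b c d x y
  ... | yes removed | _ = contradiction (removed-edge removed) (not-¬ x~y)
  ... | no _ | yes added = inj₂ added
  ... | no ¬removed | no ¬added =
    inj₁ (trans (sym (untouched-edge (¬removed ∘ inj₁) (¬removed ∘ inj₂) (¬added ∘ inj₁) (¬added ∘ inj₂))) x~y , ¬removed)

module _ (G : Graph n) (a b c d : Fin n) where

  private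
    switchedAdj : Fin n → Fin n → Bool
    switchedAdj x y =
      if does (x ≟ y) then false else
      if does (Removed? a b c d x y) then false else
      if does (Added? a b c d x y) then true else
      Adj G x y

    Removed-sym : ∀ {x y} → Removed a b c d x y → Removed a b c d y x
    Removed-sym = Sum.map SamePair-symˡ SamePair-symˡ

    Added-sym : ∀ {x y} → Added a b c d x y → Added a b c d y x
    Added-sym = Sum.map SamePair-symˡ SamePair-symˡ

    switchedAdj-sym : ∀ x y → switchedAdj x y ≡ switchedAdj y x
    switchedAdj-sym x y
      rewrite does-⇔ (mk⇔ sym sym) (x ≟ y) (y ≟ x)
            | does-⇔ (mk⇔ Removed-sym Removed-sym) (Removed? a b c d x y) (Removed? a b c d y x)
            | does-⇔ (mk⇔ Added-sym Added-sym) (Added? a b c d x y) (Added? a b c d y x)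
            | Adj-sym G x y = refl

    switchedAdj-irrefl : ∀ x → switchedAdj x x ≡ false
    switchedAdj-irrefl x rewrite dec-true (x ≟ x) refl = refl

  switch : Graph n
  switch = fromAdj switchedAdj switchedAdj-sym switchedAdj-irrefl

  switch-switched : SwitchCond G a b c d → Switched G a b c d switch
  switch-switched (a~b , c~d , a≢c , a≢d , b≢c , b≢d , _) = switched adjacency
    where
    adjacency : ∀ x y → SwitchedAdj G a b c d x y (Adj switch x y)
    adjacency x y rewrite Adj-fromAdj switchedAdj switchedAdj-sym switchedAdj-irrefl x y =
      removed , added , untouched
      where
      a≢b = adjacent⇒≢ G a~b
      c≢d = adjacent⇒≢ G c~d

      Added⇒≢ : Added a b c d x y → x ≢ y
      Added⇒≢ (inj₁ (inj₁ (refl , refl))) = a≢c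
      Added⇒≢ (inj₁ (inj₂ (refl , refl))) = ≢-sym a≢c
      Added⇒≢ (inj₂ (inj₁ (refl , refl))) = b≢d
      Added⇒≢ (inj₂ (inj₂ (refl , refl))) = ≢-sym b≢d

      Added⇒¬Removed : Added a b c d x y → ¬ Removed a b c d x y
      Added⇒¬Removed (inj₁ (inj₁ (refl , refl))) (inj₁ p) = SamePair-∉ (SamePair-symˡ p) (≢-sym a≢c) (≢-sym b≢c)
      Added⇒¬Removed (inj₁ (inj₂ (refl , refl))) (inj₁ p) = SamePair-∉ p (≢-sym a≢c) (≢-sym b≢c)
      Added⇒¬Removed (inj₁ (inj₁ (refl , refl))) (inj₂ p) = SamePair-∉ p a≢c a≢d
      Added⇒¬Removed (inj₁ (inj₂ (refl , refl))) (inj₂ p) = SamePair-∉ (SamePair-symˡ p) a≢c a≢d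
      Added⇒¬Removed (inj₂ (inj₁ (refl , refl))) (inj₁ p) = SamePair-∉ (SamePair-symˡ p) (≢-sym a≢d) (≢-sym b≢d)
      Added⇒¬Removed (inj₂ (inj₂ (refl , refl))) (inj₁ p) = SamePair-∉ p (≢-sym a≢d) (≢-sym b≢d)
      Added⇒¬Removed (inj₂ (inj₁ (refl , refl))) (inj₂ p) = SamePair-∉ p b≢c b≢d
      Added⇒¬Removed (inj₂ (inj₂ (refl , refl))) (inj₂ p) = SamePair-∉ (SamePair-symˡ p) b≢c b≢d

      removed : Removed a b c d x y → switchedAdj x y ≡ false
      removed r with x ≟ y
      ... | yes _ = refl
      ... | no _ rewrite dec-true (Removed? a b c d x y) r = refl

      added : Added a b c d x y → switchedAdj x y ≡ true
      added r rewrite dec-false (x ≟ y) (Added⇒≢ r)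
                    | dec-false (Removed? a b c d x y) (Added⇒¬Removed r)
                    | dec-true (Added? a b c d x y) r = refl

      untouched : ¬ (SamePair x y a b ⊎ SamePair x y c d ⊎ SamePair x y a c ⊎ SamePair x y b d) →
                  switchedAdj x y ≡ Adj G x y
      untouched none with x ≟ y
      ... | yes refl = sym (Adj-irrefl G x)
      ... | no _ rewrite dec-false (Removed? a b c d x y) [ none ∘ inj₁ , none ∘ inj₂ ∘ inj₁ ]
                       | dec-false (Added? a b c d x y) [ none ∘ inj₂ ∘ inj₂ ∘ inj₁ , none ∘ inj₂ ∘ inj₂ ∘ inj₂ ] = refl

switch-preserves-degree : {G K : Graph n} {a b c d : Fin n} → SwitchCond G a b c d → Switched G a b c d K →
                          ∀ i → degree K i ≡ degree G i
switch-preserves-degree {G = G} {K} {a} {b} {c} {d} (a~b , c~d , a≢c , a≢d , b≢c , b≢d , a≁c , b≁d) S i =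
  trans (degree≡count K i) (trans (row-count i) (sym (degree≡count G i)))
  where
  a≢b = adjacent⇒≢ G a~b
  c≢d = adjacent⇒≢ G c~d
  other : ∀ {x y u v} → SamePair x y u v → x ≡ v → x ≢ u → y ≡ u
  other p x≡v x≢u = SamePair-other (SamePair-symʳ p) x≡v x≢u

  row-count : ∀ i → count (Adj K i) ≡ count (Adj G i)
  row-count i with i ≟ a | i ≟ b | i ≟ c | i ≟ d
  ... | yes refl | _ | _ | _ =
    count-exchange (Adj K i) (Adj G i) b c (removed-edge S (inj₁ (SamePair-refl a b))) a~b
      (added-edge S (inj₁ (SamePair-refl a c))) a≁c (≢-sym b≢c)
      (λ y y≢b y≢c → untouched-edge S (λ p → y≢b (SamePair-other p refl a≢b)) (λ p → SamePair-∉ p a≢c a≢d)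
                                      (λ p → y≢c (SamePair-other p refl a≢c)) (λ p → SamePair-∉ p a≢b a≢d))
  ... | no _ | yes refl | _ | _ =
    count-exchange (Adj K i) (Adj G i) a d (removed-edge S (inj₁ (inj₂ (refl , refl)))) (~-sym G a~b)
      (added-edge S (inj₂ (SamePair-refl b d))) b≁d (≢-sym a≢d)
      (λ y y≢a y≢d → untouched-edge S (λ p → y≢a (other p refl (≢-sym a≢b))) (λ p → SamePair-∉ p b≢c b≢d)
                                      (λ p → SamePair-∉ p (≢-sym a≢b) b≢c) (λ p → y≢d (SamePair-other p refl b≢d)))
  ... | no _ | no _ | yes refl | _ =
    count-exchange (Adj K i) (Adj G i) d a (removed-edge S (inj₂ (SamePair-refl c d))) c~d
      (added-edge S (inj₁ (inj₂ (refl , refl)))) (trans (Adj-sym G c a) a≁c) a≢d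
      (λ y y≢d y≢a → untouched-edge S (λ p → SamePair-∉ p (≢-sym a≢c) (≢-sym b≢c)) (λ p → y≢d (SamePair-other p refl c≢d))
                                      (λ p → y≢a (other p refl (≢-sym a≢c))) (λ p → SamePair-∉ p (≢-sym b≢c) c≢d))
  ... | no _ | no _ | no _ | yes refl =
    count-exchange (Adj K i) (Adj G i) c b (removed-edge S (inj₂ (inj₂ (refl , refl)))) (~-sym G c~d)
      (added-edge S (inj₂ (inj₂ (refl , refl)))) (trans (Adj-sym G d b) b≁d) b≢c
      (λ y y≢c y≢b → untouched-edge S (λ p → SamePair-∉ p (≢-sym a≢d) (≢-sym b≢d)) (λ p → y≢c (other p refl (≢-sym c≢d)))
                                      (λ p → SamePair-∉ p (≢-sym a≢d) (≢-sym c≢d)) (λ p → y≢b (other p refl (≢-sym b≢d))))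
  ... | no i≢a | no i≢b | no i≢c | no i≢d =
    count-cong {f = Adj K i} {g = Adj G i} (λ y → untouched-edge S (λ p → SamePair-∉ p i≢a i≢b) (λ p → SamePair-∉ p i≢c i≢d)
                                        (λ p → SamePair-∉ p i≢a i≢c) (λ p → SamePair-∉ p i≢b i≢d))

-- Chains of 2-switches and the discrete intermediate value theorem

data SwitchChain (P : Graph n → Set) : Graph n → Graph n → Set where
  done    : ∀ {G} → SwitchChain P G G
  step    : ∀ {G H} → SwitchStep G H → SwitchChain P G H
  reverse : ∀ {G H} → SwitchChain P G H → SwitchChain P H G
  via     : ∀ {G K H} → SwitchChain P G K → P K → SwitchChain P K H → SwitchChain P G H

≡⇒SwitchChain : {P : Graph n → Set} {G H : Graph n} → G ≡ H → SwitchChain P G H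
≡⇒SwitchChain refl = done

∣i-j∣≤1⇒squeeze : {i j k : ℤ} → ∣ i ℤ.- j ∣ ≤ 1 → j ℤ.≤ k → k ℤ.≤ i → k ≡ i ⊎ k ≡ j
∣i-j∣≤1⇒squeeze {i} {j} {k} ∣i-j∣≤1 j≤k k≤i with k ℤ.≟ j
... | yes k≡j = inj₂ k≡j
... | no  k≢j = inj₁ (ℤ.≤-antisym k≤i (ℤ.≤-trans i≤1+j (ℤ.i<j⇒suc[i]≤j (ℤ.≤∧≢⇒< j≤k (k≢j ∘ sym)))))
  where
  i-j≤1 : i ℤ.- j ℤ.≤ ℤ.+ 1
  i-j≤1 = subst (ℤ._≤ ℤ.+ 1) (trans (cong ℤ.+_ (ℤ.∣i-j∣≡∣j-i∣ i j)) (ℤ.∣-∣-≤ (ℤ.≤-trans j≤k k≤i))) (ℤ.+≤+ ∣i-j∣≤1)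
  i-j+j≡i : i ℤ.- j ℤ.+ j ≡ i
  i-j+j≡i = trans (ℤ.+-assoc i (ℤ.- j) j) (trans (cong (λ t → i ℤ.+ t) (ℤ.+-inverseˡ j)) (ℤ.+-identityʳ i))
  i≤1+j : i ℤ.≤ ℤ.suc j
  i≤1+j = subst (ℤ._≤ ℤ.suc j) i-j+j≡i (ℤ.+-monoˡ-≤ j i-j≤1)

module _ (ξ : GraphParameter) (stable : StableUnder2Switch ξ) {P : Graph n → Set} where

  Between : ℤ → Graph n → Graph n → Set
  Between z G H = (ξ G ℤ.≤ z × z ℤ.≤ ξ H) ⊎ (ξ H ℤ.≤ z × z ℤ.≤ ξ G)

  step-close : {G H : Graph n} → SwitchStep G H → ∣ ξ H ℤ.- ξ G ∣ ≤ 1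
  step-close {G} {H} (a , b , c , d , C , S) = stable G H a b c d (inj₁ (C , Switched.adjacency S))

  SwitchChain-attains : ∀ {G H} → SwitchChain P G H → P G → P H → ∀ z → Between z G H → ∃ λ K → P K × ξ K ≡ z
  SwitchChain-attains {G} done pG _ z (inj₁ (ξG≤z , z≤ξG)) = G , pG , ℤ.≤-antisym ξG≤z z≤ξG
  SwitchChain-attains {G} done pG _ z (inj₂ (ξG≤z , z≤ξG)) = G , pG , ℤ.≤-antisym ξG≤z z≤ξG
  SwitchChain-attains {G} {H} (step s) pG pH z (inj₁ (ξG≤z , z≤ξH)) =
    [ (λ z≡ξH → H , pH , sym z≡ξH) , (λ z≡ξG → G , pG , sym z≡ξG) ]
      (∣i-j∣≤1⇒squeeze (step-close s) ξG≤z z≤ξH)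
  SwitchChain-attains {G} {H} (step s) pG pH z (inj₂ (ξH≤z , z≤ξG)) =
    [ (λ z≡ξG → G , pG , sym z≡ξG) , (λ z≡ξH → H , pH , sym z≡ξH) ]
      (∣i-j∣≤1⇒squeeze (subst (_≤ 1) (ℤ.∣i-j∣≡∣j-i∣ (ξ H) (ξ G)) (step-close s)) ξH≤z z≤ξG)
  SwitchChain-attains (reverse c) pG pH z between = SwitchChain-attains c pH pG z (Sum.swap between)
  SwitchChain-attains (via {K = K} c pK d) pG pH z (inj₁ (ξG≤z , z≤ξH)) with ℤ.≤-total z (ξ K)
  ... | inj₁ z≤ξK = SwitchChain-attains c pG pK z (inj₁ (ξG≤z , z≤ξK))
  ... | inj₂ ξK≤z = SwitchChain-attains d pK pH z (inj₁ (ξK≤z , z≤ξH))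
  SwitchChain-attains (via {K = K} c pK d) pG pH z (inj₂ (ξH≤z , z≤ξG)) with ℤ.≤-total z (ξ K)
  ... | inj₁ z≤ξK = SwitchChain-attains d pK pH z (inj₂ (ξH≤z , z≤ξK))
  ... | inj₂ ξK≤z = SwitchChain-attains c pG pK z (inj₂ (ξK≤z , z≤ξG))

  switch-connected⇒IntervalProperty : (∀ G H → P G → P H → SwitchChain P G H) → IntervalProperty ξ P
  switch-connected⇒IntervalProperty connected G H pG pH z ξG≤z z≤ξH =
    SwitchChain-attains (connected G H pG pH) pG pH z (inj₁ (ξG≤z , z≤ξH))

-- Isolating a vertex and attaching it again

Isolated : Graph n → Fin n → Set
Isolated K w = ∀ y → Adj K w y ≡ false

Isolated-sym : (K : Graph n) {w : Fin n} → Isolated K w → ∀ x → Adj K x w ≡ false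
Isolated-sym K {w} w-isolated x = trans (Adj-sym K x w) (w-isolated x)

Isolated⇒≢ : (K : Graph n) {w x y : Fin n} → Isolated K w → x ~[ K ] y → x ≢ w × y ≢ w
Isolated⇒≢ K w-isolated x~y =
  (λ { refl → contradiction (w-isolated _) (not-¬ x~y) }) ,
  (λ { refl → contradiction (Isolated-sym K w-isolated _) (not-¬ x~y) })

module _ (G : Graph n) (w : Fin n) where

  private
    isolatedAdj : Fin n → Fin n → Bool
    isolatedAdj x y = if does (x ≟ w) then false else if does (y ≟ w) then false else Adj G x y

    isolatedAdj-sym : ∀ x y → isolatedAdj x y ≡ isolatedAdj y x
    isolatedAdj-sym x y with x ≟ w | y ≟ w
    ... | yes _ | yes _ = refl
    ... | yes _ | no  _ = refl
    ... | no  _ | yes _ = refl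
    ... | no  _ | no  _ = Adj-sym G x y

    isolatedAdj-irrefl : ∀ x → isolatedAdj x x ≡ false
    isolatedAdj-irrefl x with x ≟ w
    ... | yes _ = refl
    ... | no  _ = Adj-irrefl G x

  isolate : Graph n
  isolate = fromAdj isolatedAdj isolatedAdj-sym isolatedAdj-irrefl

  isolate-isolated : Isolated isolate w
  isolate-isolated y rewrite Adj-fromAdj isolatedAdj isolatedAdj-sym isolatedAdj-irrefl w y
                           | dec-true (w ≟ w) refl = refl

  isolate-other : ∀ {x y} → x ≢ w → y ≢ w → Adj isolate x y ≡ Adj G x y
  isolate-other {x} {y} x≢w y≢w rewrite Adj-fromAdj isolatedAdj isolatedAdj-sym isolatedAdj-irrefl x y
                                      | dec-false (x ≟ w) x≢w | dec-false (y ≟ w) y≢w = refl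

  isolate-⊆ : ∀ {x y} → x ~[ isolate ] y → x ~[ G ] y
  isolate-⊆ x~y = let x≢w , y≢w = Isolated⇒≢ isolate isolate-isolated x~y in
                  trans (sym (isolate-other x≢w y≢w)) x~y

  degree-isolate-self : degree isolate w ≡ 0
  degree-isolate-self = trans (degree≡count isolate w) (count-false (Adj isolate w) isolate-isolated)

  degree-isolate-≤ : ∀ i → degree isolate i ≤ degree G i
  degree-isolate-≤ i rewrite degree≡count isolate i | degree≡count G i =
    count-mono (Adj isolate i) (Adj G i) (λ _ → isolate-⊆)

module _ (K : Graph n) (w : Fin n) (N : Fin n → Bool) (N-irrefl : N w ≡ false) where

  private
    attachedAdj : Fin n → Fin n → Bool
    attachedAdj x y = if does (x ≟ w) then N y else if does (y ≟ w) then N x else Adj K x y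

    attachedAdj-sym : ∀ x y → attachedAdj x y ≡ attachedAdj y x
    attachedAdj-sym x y with x ≟ w | y ≟ w
    ... | yes refl | yes refl = refl
    ... | yes _    | no  _    = refl
    ... | no  _    | yes _    = refl
    ... | no  _    | no  _    = Adj-sym K x y

    attachedAdj-irrefl : ∀ x → attachedAdj x x ≡ false
    attachedAdj-irrefl x with x ≟ w
    ... | yes refl = N-irrefl
    ... | no  _    = Adj-irrefl K x

  attach : Graph n
  attach = fromAdj attachedAdj attachedAdj-sym attachedAdj-irrefl

  attach-self : ∀ y → Adj attach w y ≡ N y
  attach-self y rewrite Adj-fromAdj attachedAdj attachedAdj-sym attachedAdj-irrefl w y
                      | dec-true (w ≟ w) refl = refl

  attach-selfʳ : ∀ {x} → x ≢ w → Adj attach x w ≡ N x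
  attach-selfʳ {x} x≢w rewrite Adj-fromAdj attachedAdj attachedAdj-sym attachedAdj-irrefl x w
                             | dec-false (x ≟ w) x≢w | dec-true (w ≟ w) refl = refl

  attach-other : ∀ {x y} → x ≢ w → y ≢ w → Adj attach x y ≡ Adj K x y
  attach-other {x} {y} x≢w y≢w rewrite Adj-fromAdj attachedAdj attachedAdj-sym attachedAdj-irrefl x y
                                     | dec-false (x ≟ w) x≢w | dec-false (y ≟ w) y≢w = refl

  degree-attach-self : degree attach w ≡ count N
  degree-attach-self = trans (degree≡count attach w) (count-cong attach-self)

  degree-attach-other : Isolated K w → ∀ {i} → i ≢ w → degree attach i ≡ indicator (N i) + degree K i
  degree-attach-other w-isolated {i} i≢w rewrite degree≡count attach i | degree≡count K i with N i in Ni
  ... | true  = count-flip (Adj attach i) (Adj K i) w (trans (attach-selfʳ i≢w) Ni) (Isolated-sym K w-isolated i)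
                  (λ _ y≢w → attach-other i≢w y≢w)
  ... | false = count-cong same-row
    where
    same-row : ∀ y → Adj attach i y ≡ Adj K i y
    same-row y with y ≟ w
    ... | yes refl = trans (attach-selfʳ i≢w) (trans Ni (sym (Isolated-sym K w-isolated i)))
    ... | no  y≢w  = attach-other i≢w y≢w

attach-isolate : (G : Graph n) (w : Fin n) (N : Fin n → Bool) (N-irrefl : N w ≡ false) →
                 (∀ y → N y ≡ Adj G w y) → attach (isolate G w) w N N-irrefl ≡ G
attach-isolate G w N N-irrefl N≗row = graph-ext _ _ same
  where
  same : ∀ x y → Adj (attach (isolate G w) w N N-irrefl) x y ≡ Adj G x y
  same x y with x ≟ w | y ≟ w
  ... | yes refl | _        = trans (attach-self (isolate G w) w N N-irrefl y) (N≗row y)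
  ... | no x≢w   | yes refl = trans (attach-selfʳ (isolate G w) w N N-irrefl x≢w) (trans (N≗row x) (Adj-sym G y x))
  ... | no x≢w   | no y≢w   = trans (attach-other (isolate G w) w N N-irrefl x≢w y≢w) (isolate-other G w x≢w y≢w)

SwitchStep-attach : {K K′ : Graph n} {w : Fin n} {N : Fin n → Bool} (N-irrefl : N w ≡ false) →
                    Isolated K w → SwitchStep K K′ →
                    SwitchStep (attach K w N N-irrefl) (attach K′ w N N-irrefl)
SwitchStep-attach {K = K} {K′} {w} {N} N-irrefl w-isolated
                  (a , b , c , d , (a~b , c~d , a≢c , a≢d , b≢c , b≢d , a≁c , b≁d) , S) =
  a , b , c , d , C , switched adjacency
  where
  L  = attach K w N N-irrefl
  L′ = attach K′ w N N-irrefl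
  a≢w = proj₁ (Isolated⇒≢ K w-isolated a~b)
  b≢w = proj₂ (Isolated⇒≢ K w-isolated a~b)
  c≢w = proj₁ (Isolated⇒≢ K w-isolated c~d)
  d≢w = proj₂ (Isolated⇒≢ K w-isolated c~d)
  C : SwitchCond L a b c d
  C = trans (attach-other K w N N-irrefl a≢w b≢w) a~b , trans (attach-other K w N N-irrefl c≢w d≢w) c~d ,
      a≢c , a≢d , b≢c , b≢d ,
      trans (attach-other K w N N-irrefl a≢w c≢w) a≁c , trans (attach-other K w N N-irrefl b≢w d≢w) b≁d
  w∉ : ∀ {y u v} → u ≢ w → v ≢ w → ¬ SamePair w y u v
  w∉ u≢w v≢w p = SamePair-∉ p (≢-sym u≢w) (≢-sym v≢w)
  ∉w : ∀ {x u v} → u ≢ w → v ≢ w → ¬ SamePair x w u v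
  ∉w u≢w v≢w = w∉ u≢w v≢w ∘ SamePair-symˡ
  adjacency : ∀ x y → SwitchedAdj L a b c d x y (Adj L′ x y)
  adjacency x y with x ≟ w | y ≟ w
  ... | yes refl | _ =
    (λ r → ⊥-elim ([ w∉ a≢w b≢w , w∉ c≢w d≢w ] r)) ,
    (λ r → ⊥-elim ([ w∉ a≢w c≢w , w∉ b≢w d≢w ] r)) ,
    (λ _ → trans (attach-self K′ w N N-irrefl y) (sym (attach-self K w N N-irrefl y)))
  ... | no x≢w | yes refl =
    (λ r → ⊥-elim ([ ∉w a≢w b≢w , ∉w c≢w d≢w ] r)) ,
    (λ r → ⊥-elim ([ ∉w a≢w c≢w , ∉w b≢w d≢w ] r)) ,
    (λ _ → trans (attach-selfʳ K′ w N N-irrefl x≢w) (sym (attach-selfʳ K w N N-irrefl x≢w)))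
  ... | no x≢w | no y≢w
    rewrite attach-other K′ w N N-irrefl x≢w y≢w | attach-other K w N N-irrefl x≢w y≢w =
    Switched.adjacency S x y

SwitchChain-attach : {P Q : Graph n → Set} {w : Fin n} {N : Fin n → Bool} (N-irrefl : N w ≡ false) →
                     (∀ K → P K → Isolated K w) → (∀ K → P K → Q (attach K w N N-irrefl)) →
                     ∀ {G H} → SwitchChain P G H → P G → P H →
                     SwitchChain Q (attach G w N N-irrefl) (attach H w N N-irrefl)
SwitchChain-attach N-irrefl isolated P⇒Q done          pG pH = done
SwitchChain-attach N-irrefl isolated P⇒Q (step s)      pG pH =
  step (SwitchStep-attach N-irrefl (isolated _ pG) s)
SwitchChain-attach N-irrefl isolated P⇒Q (reverse c)   pG pH = reverse (SwitchChain-attach N-irrefl isolated P⇒Q c pH pG)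
SwitchChain-attach N-irrefl isolated P⇒Q (via c pK c′) pG pH =
  via (SwitchChain-attach N-irrefl isolated P⇒Q c pG pK) (P⇒Q _ pK) (SwitchChain-attach N-irrefl isolated P⇒Q c′ pK pH)

degree-isolate : (G : Graph n) (w : Fin n) {i : Fin n} → i ≢ w →
                 degree G i ≡ indicator (Adj G w i) + degree (isolate G w) i
degree-isolate G w {i} i≢w = begin
  degree G i                                                     ≡⟨ cong (λ K → degree K i) restore ⟨
  degree (attach (isolate G w) w (Adj G w) (Adj-irrefl G w)) i   ≡⟨ degree-attach-other _ w _ _ (isolate-isolated G w) i≢w ⟩
  indicator (Adj G w i) + degree (isolate G w) i                 ∎
  where
  open ≡-Reasoning
  restore = attach-isolate G w (Adj G w) (Adj-irrefl G w) (λ _ → refl)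

isolate-same-degrees : {d : Fin n → ℕ} (G H : Graph n) (w : Fin n) → HasDegrees d G → HasDegrees d H →
                       (∀ y → Adj G w y ≡ Adj H w y) → HasDegrees (degree (isolate G w)) (isolate H w)
isolate-same-degrees G H w dG dH same-row i with i ≟ w
... | yes refl = trans (degree-isolate-self H i) (sym (degree-isolate-self G i))
... | no  i≢w  = +-cancelˡ-≡ (indicator (Adj G w i)) _ _ (begin
  indicator (Adj G w i) + degree (isolate H w) i ≡⟨ cong (λ b → indicator b + _) (same-row i) ⟩
  indicator (Adj H w i) + degree (isolate H w) i ≡⟨ degree-isolate H w i≢w ⟨
  degree H i                                     ≡⟨ trans (dH i) (sym (dG i)) ⟩
  degree G i                                     ≡⟨ degree-isolate G w i≢w ⟩
  indicator (Adj G w i) + degree (isolate G w) i ∎)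
  where open ≡-Reasoning

degrees-zero⇒≡ : {d : Fin n → ℕ} (G H : Graph n) → HasDegrees d G → HasDegrees d H → (∀ i → d i ≡ 0) → G ≡ H
degrees-zero⇒≡ G H dG dH d≡0 = graph-ext G H (λ x y →
  trans (degree≡0⇒isolated G x (trans (dG x) (d≡0 x)) y) (sym (degree≡0⇒isolated H x (trans (dH x) (d≡0 x)) y)))

-- Connectivity by peeling off one vertex at a time

positive : ℕ → Bool
positive zero    = false
positive (suc _) = true

positive-mono : ∀ {a b} → a ≤ b → positive a ≡ true → positive b ≡ true
positive-mono {suc a} {suc b} _ _ = refl

positive⇒>0 : ∀ {a} → positive a ≡ true → 0 < a
positive⇒>0 {suc a} _ = s≤s z≤n

positive-false : ∀ a → positive a ≡ false → a ≡ 0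
positive-false zero _ = refl

support : (Fin n → ℕ) → ℕ
support d = count (positive ∘ d)

module Peeling (Extra : Graph n → Set) (Good : (Fin n → Bool) → Set)
  (Extra-isolate : ∀ K w → Extra K → Extra (isolate K w))
  (Extra-attach : ∀ K w N N-irrefl → Extra K → Good N → Extra (attach K w N N-irrefl))
  where

  Class : (Fin n → ℕ) → Graph n → Set
  Class d K = HasDegrees d K × Extra K

  record Aligned (d : Fin n → ℕ) (G H : Graph n) : Set where
    field
      w         : Fin n
      w-active  : positive (d w) ≡ true
      G′ H′     : Graph n
      G⇝G′      : SwitchChain (Class d) G G′
      H⇝H′      : SwitchChain (Class d) H H′
      G′∈Class  : Class d G′
      H′∈Class  : Class d H′
      same-row  : ∀ y → Adj G′ w y ≡ Adj H′ w y
      good-row  : Good (Adj G′ w)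

  module _ (align : ∀ d G H → Class d G → Class d H → ∀ w → positive (d w) ≡ true → Aligned d G H) where

    peel : ∀ k d G H → Class d G → Class d H → support d ≤ k → SwitchChain (Class d) G H
    peel zero d G H (dG , _) (dH , _) support≤0 = ≡⇒SwitchChain (degrees-zero⇒≡ G H dG dH d≡0)
      where
      d≡0 : ∀ i → d i ≡ 0
      d≡0 i = positive-false (d i) (count≡0⇒false (positive ∘ d) (n≤0⇒n≡0 support≤0) i)
    peel (suc k) d G H cG@(dG , _) cH@(dH , _) support≤1+k with any? (λ w → positive (d w) ≟ᵇ true)
    ... | no none = ≡⇒SwitchChain (degrees-zero⇒≡ G H dG dH d≡0)
      where
      d≡0 : ∀ i → d i ≡ 0
      d≡0 i = positive-false (d i) (¬-not (λ pos → none (i , pos)))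
    ... | yes (w₀ , w₀-active) = G⇝H
      where
      open Aligned (align d G H cG cH w₀ w₀-active)
      dG′ = proj₁ G′∈Class
      dH′ = proj₁ H′∈Class
      N = Adj G′ w
      N-irrefl = Adj-irrefl G′ w
      G₀ = isolate G′ w
      H₀ = isolate H′ w
      d₀ : Fin n → ℕ
      d₀ = degree G₀

      G₀∈Class : Class d₀ G₀
      G₀∈Class = (λ _ → refl) , Extra-isolate G′ w (proj₂ G′∈Class)

      H₀∈Class : Class d₀ H₀
      H₀∈Class = isolate-same-degrees G′ H′ w dG′ dH′ same-row , Extra-isolate H′ w (proj₂ H′∈Class)

      support-decreases : support d₀ < support d
      support-decreases = count-< (positive ∘ d₀) (positive ∘ d)
        (λ i → positive-mono (subst (d₀ i ≤_) (dG′ i) (degree-isolate-≤ G′ w i))) w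
        (cong positive (degree-isolate-self G′ w)) w-active

      w-isolated : ∀ K → Class d₀ K → Isolated K w
      w-isolated K (dK , _) = degree≡0⇒isolated K w (trans (dK w) (degree-isolate-self G′ w))

      attach-Class : ∀ K → Class d₀ K → Class d (attach K w N N-irrefl)
      attach-Class K cK@(dK , eK) = degrees , Extra-attach K w N N-irrefl eK good-row
        where
        degrees : HasDegrees d (attach K w N N-irrefl)
        degrees i with i ≟ w
        ... | yes refl = trans (degree-attach-self K w N N-irrefl) (trans (sym (degree≡count G′ w)) (dG′ w))
        ... | no  i≢w  = begin
          degree (attach K w N N-irrefl) i ≡⟨ degree-attach-other K w N N-irrefl (w-isolated K cK) i≢w ⟩
          indicator (N i) + degree K i     ≡⟨ cong (indicator (N i) +_) (dK i) ⟩
          indicator (N i) + d₀ i           ≡⟨ degree-isolate G′ w i≢w ⟨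
          degree G′ i                      ≡⟨ dG′ i ⟩
          d i                              ∎
          where open ≡-Reasoning

      G₀⇝H₀ : SwitchChain (Class d₀) G₀ H₀
      G₀⇝H₀ = peel k d₀ G₀ H₀ G₀∈Class H₀∈Class (≤-pred (≤-trans support-decreases support≤1+k))

      G⇝H : SwitchChain (Class d) G H
      G⇝H = via G⇝G′ G′∈Class (via (≡⇒SwitchChain (sym restoreG)) (attach-Class G₀ G₀∈Class)
              (via (SwitchChain-attach N-irrefl w-isolated attach-Class G₀⇝H₀ G₀∈Class H₀∈Class) (attach-Class H₀ H₀∈Class)
                (via (≡⇒SwitchChain restoreH) H′∈Class (reverse H⇝H′))))
        where
        restoreG = attach-isolate G′ w N N-irrefl (λ _ → refl)
        restoreH = attach-isolate H′ w N N-irrefl same-row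

    connected : ∀ d G H → Class d G → Class d H → SwitchChain (Class d) G H
    connected d G H cG cH = peel n d G H cG cH (count≤n (positive ∘ d))

  prepend-G : ∀ {d G G₁ H} → SwitchStep G G₁ → Class d G₁ → Aligned d G₁ H → Aligned d G H
  prepend-G s c₁ a = record { Aligned a hiding (G⇝G′) ; G⇝G′ = via (step s) c₁ (Aligned.G⇝G′ a) }

  prepend-H : ∀ {d G H H₁} → SwitchStep H H₁ → Class d H₁ → Aligned d G H₁ → Aligned d G H
  prepend-H s c₁ a = record { Aligned a hiding (H⇝H′) ; H⇝H′ = via (step s) c₁ (Aligned.H⇝H′ a) }

-- Degree classes are connected

record Rerouted (G : Graph n) (w z x : Fin n) : Set where
  field
    graph      : Graph n
    switch-step : SwitchStep G graph
    degrees    : ∀ i → degree graph i ≡ degree G i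
    w≁z        : Adj graph w z ≡ false
    w~x        : w ~[ graph ] x
    row-other  : ∀ y → y ≢ z → y ≢ x → Adj graph w y ≡ Adj G w y

-- N(x) ∖ {z} is larger than N(z) ∖ {w, x}, since deg z ≤ deg x and w ∈ N(z) ∖ N(x).
fresh-neighbour : (G : Graph n) {w z x : Fin n} → w ~[ G ] z → Adj G w x ≡ false → w ≢ x →
                  degree G z ≤ degree G x → ∃ λ y → x ~[ G ] y × Adj G z y ≡ false × y ≢ z × y ≢ w
fresh-neighbour G {w} {z} {x} w~z w≁x w≢x deg-z≤deg-x = from-witness (count-<⇒∃ Nx Nz Nz<Nx)
  where
  Nx = unset (Adj G x) z
  Nz = unset (unset (Adj G z) w) x
  Nz<Nx : count Nz < count Nx
  Nz<Nx = +-cancelˡ-≤ (indicator (Adj G x z)) _ _ (begin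
    indicator (Adj G x z) + suc (count Nz)           ≡⟨ +-suc _ _ ⟩
    suc (indicator (Adj G x z) + count Nz)           ≡⟨ cong (λ b → suc (indicator b + count Nz)) x~z≡z~x ⟩
    suc (indicator (unset (Adj G z) w x) + count Nz) ≡⟨ cong suc (count-unset′ (unset (Adj G z) w) x) ⟨
    suc (count (unset (Adj G z) w))                  ≡⟨ count-unset (Adj G z) w (~-sym G w~z) ⟨
    count (Adj G z)                                  ≡⟨ degree≡count G z ⟨
    degree G z                                       ≤⟨ deg-z≤deg-x ⟩
    degree G x                                       ≡⟨ degree≡count G x ⟩
    count (Adj G x)                                  ≡⟨ count-unset′ (Adj G x) z ⟩
    indicator (Adj G x z) + count Nx                 ∎)
    where
    open ≤-Reasoning
    x~z≡z~x = trans (Adj-sym G x z) (sym (unset-other (Adj G z) (≢-sym w≢x)))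
  from-witness : (∃ λ y → Nx y ≡ true × Nz y ≡ false) → ∃ λ y → x ~[ G ] y × Adj G z y ≡ false × y ≢ z × y ≢ w
  from-witness (y , Nx-y , Nz-y) = y , x~y , z≁y , y≢z , y≢w
    where
    y≢z = proj₁ (unset-true (Adj G x) Nx-y)
    x~y = proj₂ (unset-true (Adj G x) Nx-y)
    y≢w : y ≢ w
    y≢w y≡w = contradiction (trans (Adj-sym G w x) (subst (x ~[ G ]_) y≡w x~y)) (not-¬ w≁x)
    z≁y : Adj G z y ≡ false
    z≁y with unset-false (unset (Adj G z) w) Nz-y
    ... | inj₁ y≡x = contradiction (subst (x ~[ G ]_) y≡x x~y) (not-¬ (Adj-irrefl G x))
    ... | inj₂ Nz-y′ with unset-false (Adj G z) Nz-y′
    ...   | inj₁ y≡w = ⊥-elim (y≢w y≡w)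
    ...   | inj₂ z≁y = z≁y

reroute : (G : Graph n) (w z x : Fin n) → w ~[ G ] z → Adj G w x ≡ false → w ≢ x →
          degree G z ≤ degree G x → Rerouted G w z x
reroute G w z x w~z w≁x w≢x deg-z≤deg-x
  with y , x~y , z≁y , y≢z , y≢w ← fresh-neighbour G w~z w≁x w≢x deg-z≤deg-x = record
  { graph       = switch G w z x y
  ; switch-step = w , z , x , y , C , S
  ; degrees     = switch-preserves-degree C S
  ; w≁z         = removed-edge S (inj₁ (SamePair-refl w z))
  ; w~x         = added-edge S (inj₁ (SamePair-refl w x))
  ; row-other   = λ y′ y′≢z y′≢x →
      untouched-edge S (λ p → y′≢z (SamePair-other p refl w≢z)) (λ p → SamePair-∉ p w≢x (≢-sym y≢w))
                       (λ p → y′≢x (SamePair-other p refl w≢x)) (λ p → SamePair-∉ p w≢z (≢-sym y≢w))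
  }
  where
  w≢z = adjacent⇒≢ G w~z
  z≢x : z ≢ x
  z≢x refl = contradiction w~z (not-¬ w≁x)
  C : SwitchCond G w z x y
  C = w~z , x~y , w≢x , ≢-sym y≢w , z≢x , ≢-sym y≢z , w≁x , z≁y
  S = switch-switched G w z x y C

discrepancy : Graph n → Graph n → Fin n → ℕ
discrepancy G H w = count (λ v → Adj G w v xor Adj H w v)

discrepancy-sym : (G H : Graph n) (w : Fin n) → discrepancy G H w ≡ discrepancy H G w
discrepancy-sym G H w = count-cong (λ v → xor-comm (Adj G w v) (Adj H w v))

discrepancy≡0⇒same-row : (G H : Graph n) (w : Fin n) → discrepancy G H w ≡ 0 → ∀ y → Adj G w y ≡ Adj H w y
discrepancy≡0⇒same-row G H w d≡0 y = xor≡false⇒≡ (Adj G w y) (Adj H w y) (count≡0⇒false _ d≡0 y)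
  where
  xor≡false⇒≡ : ∀ a b → a xor b ≡ false → a ≡ b
  xor≡false⇒≡ true  true  _ = refl
  xor≡false⇒≡ false false _ = refl

discrepancy-reroute : (G H : Graph n) {w z x : Fin n} (R : Rerouted G w z x) →
                      w ~[ G ] z → Adj H w z ≡ false → w ~[ H ] x →
                      discrepancy (Rerouted.graph R) H w < discrepancy G H w
discrepancy-reroute G H {w} {z} {x} R w~z H-w≁z H-w~x =
  count-< _ _ still-differs z (cong₂ _xor_ w≁z H-w≁z) (cong₂ _xor_ w~z H-w≁z)
  where
  open Rerouted R
  still-differs : ∀ v → (Adj graph w v xor Adj H w v) ≡ true → (Adj G w v xor Adj H w v) ≡ true
  still-differs v differs with v ≟ z | v ≟ x
  ... | yes refl | _        = contradiction (trans (sym differs) (cong₂ _xor_ w≁z H-w≁z)) λ ()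
  ... | no _     | yes refl = contradiction (trans (sym differs) (cong₂ _xor_ w~x H-w~x)) λ ()
  ... | no v≢z   | no v≢x   = trans (cong (_xor Adj H w v) (sym (row-other v v≢z v≢x))) differs

module AllGraphs {n : ℕ} = Peeling {n} (λ _ → ⊤) (λ _ → ⊤) (λ _ _ _ → tt) (λ _ _ _ _ _ _ → tt)

module _ {n : ℕ} where
  open AllGraphs {n}

  aligned-now : ∀ {d G H w} → positive (d w) ≡ true → Class d G → Class d H →
                (∀ y → Adj G w y ≡ Adj H w y) → Aligned d G H
  aligned-now w-active cG cH same-row =
    record { w-active = w-active ; G⇝G′ = done ; H⇝H′ = done ; G′∈Class = cG ; H′∈Class = cH
           ; same-row = same-row ; good-row = tt }

  differing-vertex : (G H : Graph n) (w : Fin n) → degree G w ≡ degree H w → ¬ (∀ y → Adj G w y ≡ Adj H w y) →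
                     ∃ λ z → w ~[ G ] z × Adj H w z ≡ false
  differing-vertex G H w deg-w ¬same with ¬∀⟶∃¬ n _ (λ y → Adj G w y ≟ᵇ Adj H w y) ¬same
  ... | y , differ with Adj G w y in G-wy | Adj H w y in H-wy
  ...   | true  | true  = contradiction refl differ
  ...   | false | false = contradiction refl differ
  ...   | true  | false = y , G-wy , H-wy
  ...   | false | true  = let z , H-w≁z , G-w~z = count-balance (Adj H w) (Adj G w) rows H-wy G-wy in
                          z , G-w~z , H-w≁z
    where
    rows : count (Adj H w) ≡ count (Adj G w)
    rows = trans (sym (degree≡count H w)) (trans (sym deg-w) (degree≡count G w))

  rerouted-in-class : ∀ {d G w z x} → Class d G → (R : Rerouted G w z x) → Class d (Rerouted.graph R)
  rerouted-in-class (dG , _) R = (λ i → trans (Rerouted.degrees R i) (dG i)) , tt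

  -- With wz ∈ G ∖ H and wx ∈ H ∖ G, trade wz for wx in G if deg z ≤ deg x, and wx for wz in H otherwise.
  align-row : ∀ k d G H w → positive (d w) ≡ true → Class d G → Class d H →
              discrepancy G H w ≤ k → Aligned d G H
  align-row zero d G H w w-active cG cH bound =
    aligned-now w-active cG cH (discrepancy≡0⇒same-row G H w (n≤0⇒n≡0 bound))
  align-row (suc k) d G H w w-active cG@(dG , _) cH@(dH , _) bound
    with all? (λ y → Adj G w y ≟ᵇ Adj H w y)
  ... | yes same = aligned-now w-active cG cH same
  ... | no ¬same with differing-vertex G H w (trans (dG w) (sym (dH w))) ¬same
  ... | z , G-w~z , H-w≁z with count-balance (Adj G w) (Adj H w) rows G-w~z H-w≁z
    where
    rows : count (Adj G w) ≡ count (Adj H w)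
    rows = trans (sym (degree≡count G w)) (trans (dG w) (trans (sym (dH w)) (degree≡count H w)))
  ... | x , G-w≁x , H-w~x with ≤-total (d z) (d x)
  ... | inj₁ dz≤dx =
    prepend-G switch-step (rerouted-in-class cG R)
      (align-row k d graph H w w-active (rerouted-in-class cG R) cH
        (≤-pred (≤-trans (discrepancy-reroute G H R G-w~z H-w≁z H-w~x) bound)))
    where
    R = reroute G w z x G-w~z G-w≁x (adjacent⇒≢ H H-w~x) (subst₂ _≤_ (sym (dG z)) (sym (dG x)) dz≤dx)
    open Rerouted R
  ... | inj₂ dx≤dz =
    prepend-H switch-step (rerouted-in-class cH R)
      (align-row k d G graph w w-active cG (rerouted-in-class cH R) (≤-pred (begin-strict
        discrepancy G graph w ≡⟨ discrepancy-sym G graph w ⟩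
        discrepancy graph G w <⟨ discrepancy-reroute H G R H-w~x G-w≁x G-w~z ⟩
        discrepancy H G w     ≡⟨ discrepancy-sym H G w ⟩
        discrepancy G H w     ≤⟨ bound ⟩
        suc k                 ∎)))
    where
    R = reroute H w x z H-w~x H-w≁z (adjacent⇒≢ G G-w~z) (subst₂ _≤_ (sym (dH x)) (sym (dH z)) dx≤dz)
    open Rerouted R
    open ≤-Reasoning

  degree-class-connected : (d : Fin n → ℕ) (G H : Graph n) → HasDegrees d G → HasDegrees d H →
                           SwitchChain (Class d) G H
  degree-class-connected d G H dG dH =
    connected (λ d G H cG cH w w-active → align-row _ d G H w w-active cG cH ≤-refl) d G H (dG , tt) (dH , tt)

Unique-lookup-injective : {xs : List (Fin n)} → Unique xs → ∀ {i j} → i Data.Fin.< j → List.lookup xs i ≢ List.lookup xs j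
Unique-lookup-injective {xs = x ∷ xs} (x∉xs ∷ _) {zero} {suc j} _ = All.lookup x∉xs (∈-lookup j)
Unique-lookup-injective {xs = x ∷ xs} (_ ∷ unique) {suc i} {suc j} (s≤s i<j) = Unique-lookup-injective unique i<j

Unique⇒length≤n : {xs : List (Fin n)} → Unique xs → length xs ≤ n
Unique⇒length≤n {n} {xs} unique with length xs ≤? n
... | yes length≤n = length≤n
... | no  length≰n with i , j , i<j , same ← pigeonhole (≰⇒> length≰n) (List.lookup xs) =
  ⊥-elim (Unique-lookup-injective unique i<j same)

module _ {n : ℕ} where

  infixr 5 _∷_

  data Walk (E : Fin n → Fin n → Set) : Fin n → Fin n → Set where
    []  : ∀ {x} → Walk E x x
    _∷_ : ∀ {x y z} → E x y → Walk E y z → Walk E x z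

  module _ {E : Fin n → Fin n → Set} where

    _++ʷ_ : ∀ {x y z} → Walk E x y → Walk E y z → Walk E x z
    []      ++ʷ V = V
    (e ∷ W) ++ʷ V = e ∷ (W ++ʷ V)

    reverseʷ : (∀ {x y} → E x y → E y x) → ∀ {x y} → Walk E x y → Walk E y x
    reverseʷ E-sym []      = []
    reverseʷ E-sym (e ∷ W) = reverseʷ E-sym W ++ʷ (E-sym e ∷ [])

    mapʷ : {E′ : Fin n → Fin n → Set} → (∀ {a b} → E a b → E′ a b) → ∀ {x y} → Walk E x y → Walk E′ x y
    mapʷ f []      = []
    mapʷ f (e ∷ W) = f e ∷ mapʷ f W

    steps : ∀ {x y} → Walk E x y → ℕ
    steps []      = 0
    steps (_ ∷ W) = suc (steps W)

    vertices : ∀ {x y} → Walk E x y → List (Fin n)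
    vertices {x} []      = x ∷ []
    vertices {x} (_ ∷ W) = x ∷ vertices W

    length-vertices : ∀ {x y} (W : Walk E x y) → length (vertices W) ≡ suc (steps W)
    length-vertices []      = refl
    length-vertices (_ ∷ W) = cong suc (length-vertices W)

    All-vertices-head : {Q : Fin n → Set} → ∀ {x y} (W : Walk E x y) → All Q (vertices W) → Q x
    All-vertices-head []      (q ∷ _) = q
    All-vertices-head (_ ∷ _) (q ∷ _) = q

    last-vertices : ∀ {x y z} (W : Walk E y z) → last x (vertices W) ≡ z
    last-vertices []      = refl
    last-vertices (_ ∷ W) = last-vertices W

    suffix : ∀ {x y z} (W : Walk E x y) → z ∈ vertices W →
             Σ (Walk E z y) λ W′ → Unique (vertices W) → Unique (vertices W′)
    suffix []      (here refl) = [] , λ u → u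
    suffix (e ∷ W) (here refl) = e ∷ W , λ u → u
    suffix (e ∷ W) (there z∈W) with W′ , unique′ ← suffix W z∈W = W′ , λ { (_ ∷ u) → unique′ u }

    loop-erase : ∀ {x y} → Walk E x y → Σ (Walk E x y) λ W′ → Unique (vertices W′)
    loop-erase []          = [] , [] ∷ []
    loop-erase {x} (e ∷ W) with W′ , unique ← loop-erase W | x ∈? vertices W′
      where open import Data.List.Membership.DecPropositional (_≟_ {n}) using (_∈?_)
    ... | yes x∈W′ = let W″ , unique″ = suffix W′ x∈W′ in W″ , unique″ unique
    ... | no  x∉W′ = e ∷ W′ , ¬Any⇒All¬ (vertices W′) x∉W′ ∷ unique

    Unique⇒steps<n : ∀ {x y} (W : Walk E x y) → Unique (vertices W) → steps W < n
    Unique⇒steps<n W unique = subst (_≤ n) (length-vertices W) (Unique⇒length≤n unique)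

    module _ (E? : ∀ a b → Dec (E a b)) where

      private
        ShortWalk : ℕ → Fin n → Fin n → Set
        ShortWalk zero    x y = x ≡ y
        ShortWalk (suc k) x y = x ≡ y ⊎ ∃ λ z → E x z × ShortWalk k z y

        ShortWalk? : ∀ k x y → Dec (ShortWalk k x y)
        ShortWalk? zero    x y = x ≟ y
        ShortWalk? (suc k) x y = (x ≟ y) ⊎-dec any? (λ z → E? x z ×-dec ShortWalk? k z y)

        ShortWalk⇒Walk : ∀ k {x y} → ShortWalk k x y → Walk E x y
        ShortWalk⇒Walk zero    refl                = []
        ShortWalk⇒Walk (suc k) (inj₁ refl)         = []
        ShortWalk⇒Walk (suc k) (inj₂ (_ , e , W)) = e ∷ ShortWalk⇒Walk k W

        Walk⇒ShortWalk : ∀ k {x y} (W : Walk E x y) → steps W ≤ k → ShortWalk k x y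
        Walk⇒ShortWalk zero    []      _         = refl
        Walk⇒ShortWalk (suc k) []      _         = inj₁ refl
        Walk⇒ShortWalk (suc k) (e ∷ W) (s≤s ≤k) = inj₂ (_ , e , Walk⇒ShortWalk k W ≤k)

      Walk? : ∀ x y → Dec (Walk E x y)
      Walk? x y with ShortWalk? n x y
      ... | yes short = yes (ShortWalk⇒Walk n short)
      ... | no ¬short = no λ W → let W′ , unique = loop-erase W in
        ¬short (Walk⇒ShortWalk n W′ (≤-trans (n≤1+n _) (Unique⇒steps<n W′ unique)))

    exit-edge : (A : Fin n → Set) (A? : ∀ x → Dec (A x)) → ∀ {a b} → Walk E a b → A a → ¬ A b →
                ∃₂ λ x y → E x y × A x × ¬ A y
    exit-edge A A? [] Aa ¬Ab = ⊥-elim (¬Ab Aa)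
    exit-edge A A? (_∷_ {y = y} e W) Aa ¬Ab with A? y
    ... | yes Ay = exit-edge A A? W Ay ¬Ab
    ... | no ¬Ay = _ , _ , e , Aa , ¬Ay

    -- Every excursion out of A leaves through i and has to come back through i, so it can be cut out.
    module Bridge (A : Fin n → Set) (A? : ∀ x → Dec (A x)) (i o : Fin n)
      (leave : ∀ {x y} → E x y → A x → ¬ A y → x ≡ i × y ≡ o)
      (enter : ∀ {x y} → E x y → ¬ A x → A y → x ≡ o × y ≡ i) where

      Inside : Fin n → Fin n → Set
      Inside x y = E x y × A x × A y

      project : ∀ {a b} → Walk E a b → A a → A b → Walk Inside a b
      return  : ∀ {a b} → Walk E a b → ¬ A a → A b → Walk Inside i b
      project [] _ _ = []
      project (_∷_ {y = y} e W) Aa Ab with A? y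
      ... | yes Ay = (e , Aa , Ay) ∷ project W Ay Ab
      ... | no ¬Ay with refl , _ ← leave e Aa ¬Ay = return W ¬Ay Ab
      return [] ¬Aa Ab = ⊥-elim (¬Aa Ab)
      return (_∷_ {y = y} e W) ¬Aa Ab with A? y
      ... | yes Ay with _ , refl ← enter e ¬Aa Ay = project W Ay Ab
      ... | no ¬Ay = return W ¬Ay Ab

-- Forests

module _ {n : ℕ} where

  OtherEdge : Graph n → Fin n → Fin n → Fin n → Fin n → Set
  OtherEdge G p q a b = a ~[ G ] b × ¬ SamePair a b p q

  Detour : Graph n → Fin n → Fin n → Set
  Detour G p q = Walk (OtherEdge G p q) p q

  Acyclic : Graph n → Set
  Acyclic G = ∀ p q → p ~[ G ] q → ¬ Detour G p q

  OtherEdge-sym : (G : Graph n) {p q a b : Fin n} → OtherEdge G p q a b → OtherEdge G p q b a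
  OtherEdge-sym G (a~b , ¬pq) = ~-sym G a~b , ¬pq ∘ SamePair-symˡ

  Detour-sym : (G : Graph n) {p q : Fin n} → Detour G p q → Detour G q p
  Detour-sym G D = mapʷ (λ (a~b , ¬pq) → a~b , ¬pq ∘ SamePair-symʳ) (reverseʷ (OtherEdge-sym G) D)

  Walk⇒Path : (G : Graph n) {E : Fin n → Fin n → Set} → (∀ {a b} → E a b → a ~[ G ] b) →
              ∀ {x y} (W : Walk E x y) → Path G (vertices W)
  Walk⇒Path G E⊆G []           = tt
  Walk⇒Path G E⊆G (e ∷ [])     = E⊆G e , tt
  Walk⇒Path G E⊆G (e ∷ e′ ∷ W) = E⊆G e , Walk⇒Path G E⊆G (e′ ∷ W)

  Detour⇒cycle : (G : Graph n) {p q : Fin n} → p ~[ G ] q → Detour G p q → ∃ (IsCycle G)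
  Detour⇒cycle G {p} {q} p~q D with D′ , unique ← loop-erase D = vertices D′ , cycle D′ unique
    where
    cycle : (D : Detour G p q) → Unique (vertices D) → IsCycle G (vertices D)
    cycle []           _      = ⊥-elim (adjacent⇒≢ G p~q refl)
    cycle (e ∷ [])     _      = ⊥-elim (proj₂ e (SamePair-refl p q))
    cycle (e ∷ e′ ∷ D) unique =
      s≤s (s≤s (subst (1 ≤_) (sym (length-vertices D)) (s≤s z≤n))) , unique ,
      Walk⇒Path G proj₁ (e ∷ e′ ∷ D) , subst (_~[ G ] p) (sym (last-vertices {x = p} (e′ ∷ D))) (~-sym G p~q)

  cycle⇒Detour : (G : Graph n) (vs : List (Fin n)) → IsCycle G vs → ∃₂ λ p q → p ~[ G ] q × Detour G p q
  cycle⇒Detour G (x ∷ y ∷ z ∷ rest) (_ , (x∉ ∷ (y∉ ∷ _)) , (x~y , path) , closing) =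
    x , L , ~-sym G closing , (x~y , ¬xL) ∷ detour y (z ∷ rest) path (All.head x∉ ∷ All.tail x∉)
    where
    L = last z rest
    last∈ : ∀ u us → last u us ∈ u ∷ us
    last∈ u []       = here refl
    last∈ u (v ∷ vs) = there (last∈ v vs)
    ¬xL : ¬ SamePair x y x L
    ¬xL (inj₁ (_ , y≡L)) = All.lookup y∉ (last∈ z rest) y≡L
    ¬xL (inj₂ (_ , y≡x)) = All.head x∉ (sym y≡x)
    detour : ∀ u us → Path G (u ∷ us) → All (x ≢_) (u ∷ us) → Walk (OtherEdge G x L) u (last u us)
    detour u []       _              _                  = []
    detour u (v ∷ vs) (u~v , path′) (x≢u ∷ x≢v ∷ x∉vs) = (u~v , ¬xL′) ∷ detour v vs path′ (x≢v ∷ x∉vs)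
      where
      ¬xL′ : ¬ SamePair u v x L
      ¬xL′ (inj₁ (u≡x , _)) = x≢u (sym u≡x)
      ¬xL′ (inj₂ (_ , v≡x)) = x≢v (sym v≡x)
  cycle⇒Detour G (_ ∷ [])     (s≤s () , _)
  cycle⇒Detour G (_ ∷ _ ∷ []) (s≤s (s≤s ()) , _)

  Acyclic⇒IsForest : {G : Graph n} → Acyclic G → IsForest G
  Acyclic⇒IsForest {G} acyclic (vs , cycle) = let p , q , p~q , D = cycle⇒Detour G vs cycle in acyclic p q p~q D

  IsForest⇒Acyclic : {G : Graph n} → IsForest G → Acyclic G
  IsForest⇒Acyclic {G} forest p q p~q D = forest (Detour⇒cycle G p~q D)

  pendant⇒¬Detour : (G : Graph n) {ℓ v p q : Fin n} → (∀ y → ℓ ~[ G ] y → y ≡ v) → p ~[ G ] q →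
                    p ≡ ℓ ⊎ q ≡ ℓ → ¬ Detour G p q
  pendant⇒¬Detour G leaf p~q (inj₁ refl) = from-leaf G leaf p~q
    where
    from-leaf : ∀ G {ℓ v q} → (∀ y → ℓ ~[ G ] y → y ≡ v) → ℓ ~[ G ] q → ¬ Detour G ℓ q
    from-leaf G leaf ℓ~q []                          = adjacent⇒≢ G ℓ~q refl
    from-leaf G leaf ℓ~q (_∷_ {y = y} (ℓ~y , ¬ℓq) _) = ¬ℓq (inj₁ (refl , trans (leaf y ℓ~y) (sym (leaf _ ℓ~q))))
  pendant⇒¬Detour G leaf p~q (inj₂ refl) D = pendant⇒¬Detour G leaf (~-sym G p~q) (inj₁ refl) (Detour-sym G D)

  Acyclic-isolate : (G : Graph n) (w : Fin n) → Acyclic G → Acyclic (isolate G w)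
  Acyclic-isolate G w acyclic p q p~q D =
    acyclic p q (isolate-⊆ G w p~q) (mapʷ (λ (a~b , ¬pq) → isolate-⊆ G w a~b , ¬pq) D)

  Acyclic-attach : (K : Graph n) (w : Fin n) (N : Fin n → Bool) (N-irrefl : N w ≡ false) →
                   Acyclic K → count N ≡ 1 → Acyclic (attach K w N N-irrefl)
  Acyclic-attach K w N N-irrefl acyclic count≡1 p q p~q D
    with v , Nv ← count>0⇒∃ N (subst (0 <_) (sym count≡1) (s≤s z≤n)) = no-detour
    where
    L = attach K w N N-irrefl
    only-v : ∀ y → w ~[ L ] y → y ≡ v
    only-v y w~y = count≡1⇒unique N count≡1 Nv (trans (sym (attach-self K w N N-irrefl y)) w~y)
    leave : ∀ {x y} → OtherEdge L p q x y → x ≢ w → ¬ (y ≢ w) → x ≡ v × y ≡ w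
    leave {x} (x~y , _) _ ¬y≢w with refl ← decidable-stable (_ ≟ w) ¬y≢w = only-v x (~-sym L x~y) , refl
    enter : ∀ {x y} → OtherEdge L p q x y → ¬ (x ≢ w) → y ≢ w → x ≡ w × y ≡ v
    enter {y = y} (x~y , _) ¬x≢w _ with refl ← decidable-stable (_ ≟ w) ¬x≢w = refl , only-v y x~y
    open Bridge {E = OtherEdge L p q} (_≢ w) (λ x → ¬? (x ≟ w)) v w leave enter
    no-detour : ⊥
    no-detour with p ≟ w | q ≟ w
    ... | yes p≡w | _       = pendant⇒¬Detour L only-v p~q (inj₁ p≡w) D
    ... | no _    | yes q≡w = pendant⇒¬Detour L only-v p~q (inj₂ q≡w) D
    ... | no p≢w   | no q≢w   =
      acyclic p q (trans (sym (attach-other K w N N-irrefl p≢w q≢w)) p~q)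
        (mapʷ (λ ((a~b , ¬pq) , a≢w , b≢w) → trans (sym (attach-other K w N N-irrefl a≢w b≢w)) a~b , ¬pq) (project D p≢w q≢w))

-- A 2-switch that keeps a forest acyclic

module _ {n : ℕ} where

  EdgeAvoiding : Graph n → Fin n → Fin n → Fin n → Set
  EdgeAvoiding G v a b = a ~[ G ] b × a ≢ v × b ≢ v

  EdgeAvoiding? : (G : Graph n) (v a b : Fin n) → Dec (EdgeAvoiding G v a b)
  EdgeAvoiding? G v a b = (Adj G a b ≟ᵇ true) ×-dec (¬? (a ≟ v) ×-dec ¬? (b ≟ v))

  EdgeAvoiding-sym : (G : Graph n) {v a b : Fin n} → EdgeAvoiding G v a b → EdgeAvoiding G v b a
  EdgeAvoiding-sym G (a~b , a≢v , b≢v) = ~-sym G a~b , b≢v , a≢v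

  -- Writing A for the component of w in G − u′, the switch (ℓ u / u′ w) leaves wu as the only edge
  -- between A and the rest, and ℓ stays a leaf, so a cycle after the switch would give one before.
  module LeafSwitch (G : Graph n) (acyclic : Acyclic G) (ℓ u u′ w : Fin n)
    (ℓ~u : ℓ ~[ G ] u) (leaf : ∀ t → ℓ ~[ G ] t → t ≡ u)
    (u′~w : u′ ~[ G ] w) (u≢u′ : u ≢ u′) (separated : ¬ Walk (EdgeAvoiding G u′) u w) where

    private
      A : Fin n → Set
      A v = Walk (EdgeAvoiding G u′) v w

      A? : ∀ v → Dec (A v)
      A? v = Walk? (EdgeAvoiding? G u′) v w

      w≢u′ = ≢-sym (adjacent⇒≢ G u′~w)
      u≢w : u ≢ w
      u≢w refl = separated []
      u≁w : Adj G u w ≡ false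
      u≁w with Adj G u w in u~w
      ... | true  = ⊥-elim (separated ((u~w , u≢u′ , w≢u′) ∷ []))
      ... | false = refl
      ℓ≢u′ : ℓ ≢ u′
      ℓ≢u′ refl = u≢w (sym (leaf w u′~w))
      ℓ≢w : ℓ ≢ w
      ℓ≢w refl = u≢u′ (sym (leaf u′ (~-sym G u′~w)))
      ℓ≁u′ : Adj G ℓ u′ ≡ false
      ℓ≁u′ with Adj G ℓ u′ in ℓ~u′
      ... | true  = ⊥-elim (u≢u′ (sym (leaf u′ ℓ~u′)))
      ... | false = refl
      ℓ≢u = adjacent⇒≢ G ℓ~u

    C : SwitchCond G ℓ u u′ w
    C = ℓ~u , u′~w , ℓ≢u′ , ℓ≢w , u≢u′ , u≢w , ℓ≁u′ , u≁w

    G′ : Graph n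
    G′ = switch G ℓ u u′ w

    S : Switched G ℓ u u′ w G′
    S = switch-switched G ℓ u u′ w C

    ℓ~u′ : ℓ ~[ G′ ] u′
    ℓ~u′ = added-edge S (inj₁ (SamePair-refl ℓ u′))

    private
      old-edge : ∀ {a b} → a ~[ G′ ] b → ¬ SamePair a b ℓ u′ → ¬ SamePair a b u w → a ~[ G ] b
      old-edge a~b ¬ℓu′ ¬uw with switched-edge S a~b
      ... | inj₁ (a~b , _)   = a~b
      ... | inj₂ (inj₁ ℓu′)  = ⊥-elim (¬ℓu′ ℓu′)
      ... | inj₂ (inj₂ uw)   = ⊥-elim (¬uw uw)

      ℓ-leaf : ∀ y → ℓ ~[ G′ ] y → y ≡ u′
      ℓ-leaf y ℓ~y with switched-edge S ℓ~y
      ... | inj₁ (ℓ~y , ¬removed) = ⊥-elim (¬removed (inj₁ (inj₁ (refl , leaf y ℓ~y))))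
      ... | inj₂ (inj₁ ℓu′)      = SamePair-other ℓu′ refl ℓ≢u′
      ... | inj₂ (inj₂ ub)       = ⊥-elim (SamePair-∉ ub ℓ≢u ℓ≢w)

      w∈A : A w
      w∈A = []
      u′∉A : ¬ A u′
      u′∉A []                    = w≢u′ refl
      u′∉A ((_ , u′≢u′ , _) ∷ _) = u′≢u′ refl
      ℓ∉A : ¬ A ℓ
      ℓ∉A []                          = ℓ≢w refl
      ℓ∉A (_∷_ {y = y} (ℓ~y , _) W) with refl ← leaf y ℓ~y = separated W

      A-closed : ∀ {x y} → A y → x ~[ G ] y → x ≢ u′ → A x
      A-closed Ay x~y x≢u′ = (x~y , x≢u′ , λ { refl → u′∉A Ay }) ∷ Ay

      u′-neighbour-in-A : ∀ {x} → A x → u′ ~[ G ] x → x ≡ w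
      u′-neighbour-in-A {x} Ax u′~x with x ≟ w
      ... | yes x≡w = x≡w
      ... | no  x≢w = ⊥-elim (acyclic u′ w u′~w ((u′~x , ¬u′w) ∷ mapʷ avoid Ax))
        where
        ¬u′w : ¬ SamePair u′ x u′ w
        ¬u′w (inj₁ (_ , x≡w)) = x≢w x≡w
        ¬u′w (inj₂ (u′≡w , _)) = w≢u′ (sym u′≡w)
        avoid : ∀ {a b} → EdgeAvoiding G u′ a b → OtherEdge G u′ w a b
        avoid (a~b , a≢u′ , b≢u′) = a~b , λ { (inj₁ (a≡u′ , _)) → a≢u′ a≡u′ ; (inj₂ (_ , b≡u′)) → b≢u′ b≡u′ }

      leave-A : ∀ {x y} → x ~[ G′ ] y → A x → ¬ A y → x ≡ w × y ≡ u
      leave-A {x} {y} x~y Ax ¬Ay with switched-edge S x~y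
      ... | inj₁ (x~y , ¬removed) with y ≟ u′
      ...   | yes refl = ⊥-elim (¬removed (inj₂ (inj₂ (u′-neighbour-in-A Ax (~-sym G x~y) , refl))))
      ...   | no  y≢u′ = ⊥-elim (¬Ay (A-closed Ax (~-sym G x~y) y≢u′))
      leave-A _ Ax _ | inj₂ (inj₁ (inj₁ (refl , _))) = ⊥-elim (ℓ∉A Ax)
      leave-A _ Ax _ | inj₂ (inj₁ (inj₂ (refl , _))) = ⊥-elim (u′∉A Ax)
      leave-A _ Ax _ | inj₂ (inj₂ (inj₁ (refl , _))) = ⊥-elim (separated Ax)
      leave-A _ _  _ | inj₂ (inj₂ (inj₂ wu))         = wu

      enter-A : ∀ {x y} → x ~[ G′ ] y → ¬ A x → A y → x ≡ u × y ≡ w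
      enter-A x~y ¬Ax Ay = let y≡w , x≡u = leave-A (~-sym G′ x~y) Ay ¬Ax in x≡u , y≡w

      crossing⇒¬Detour : ∀ {p q} → p ~[ G′ ] q → A p → ¬ A q → ¬ Detour G′ p q
      crossing⇒¬Detour p~q Ap ¬Aq D
        with refl , refl ← leave-A p~q Ap ¬Aq
           | x , y , (x~y , ¬pq) , Ax , ¬Ay ← exit-edge A A? D Ap ¬Aq
        with refl , refl ← leave-A x~y Ax ¬Ay = ¬pq (SamePair-refl x y)

      inside⇒¬Detour : ∀ {p q} → p ~[ G′ ] q → A p → A q → ¬ Detour G′ p q
      inside⇒¬Detour {p} {q} p~q Ap Aq D =
        acyclic p q (old-edge p~q (¬ℓu′ Ap) (¬uw Ap Aq)) (mapʷ back (project D Ap Aq))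
        where
        leave : ∀ {x y} → OtherEdge G′ p q x y → A x → ¬ A y → x ≡ w × y ≡ u
        leave (x~y , _) = leave-A x~y
        enter : ∀ {x y} → OtherEdge G′ p q x y → ¬ A x → A y → x ≡ u × y ≡ w
        enter (x~y , _) = enter-A x~y
        open Bridge A A? w u leave enter
        ¬ℓu′ : ∀ {a b} → A a → ¬ SamePair a b ℓ u′
        ¬ℓu′ Aa (inj₁ (refl , _)) = ℓ∉A Aa
        ¬ℓu′ Aa (inj₂ (refl , _)) = u′∉A Aa
        ¬uw : ∀ {a b} → A a → A b → ¬ SamePair a b u w
        ¬uw Aa Ab (inj₁ (refl , _)) = separated Aa
        ¬uw Aa Ab (inj₂ (_ , refl)) = separated Ab
        back : ∀ {a b} → Inside a b → OtherEdge G p q a b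
        back ((a~b , ¬pq) , Aa , Ab) = old-edge a~b (¬ℓu′ Aa) (¬uw Aa Ab) , ¬pq

      outside⇒¬Detour : ∀ {p q} → p ~[ G′ ] q → ¬ A p → ¬ A q → p ≢ ℓ → q ≢ ℓ → ¬ Detour G′ p q
      outside⇒¬Detour {p} {q} p~q ¬Ap ¬Aq p≢ℓ q≢ℓ D =
        acyclic p q (old-edge p~q (¬ℓu′ p≢ℓ q≢ℓ) (¬uw ¬Ap ¬Aq))
          (mapʷ back (Inner.project (Outer.project D ¬Ap ¬Aq) (¬Ap , p≢ℓ) (¬Aq , q≢ℓ)))
        where
        leave : ∀ {x y} → OtherEdge G′ p q x y → ¬ A x → ¬ ¬ A y → x ≡ u × y ≡ w
        leave (x~y , _) ¬Ax ¬¬Ay = enter-A x~y ¬Ax (decidable-stable (A? _) ¬¬Ay)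
        enter : ∀ {x y} → OtherEdge G′ p q x y → ¬ ¬ A x → ¬ A y → x ≡ w × y ≡ u
        enter (x~y , _) ¬¬Ax = leave-A x~y (decidable-stable (A? _) ¬¬Ax)
        module Outer = Bridge (¬_ ∘ A) (¬? ∘ A?) u w leave enter

        B : Fin n → Set
        B x = ¬ A x × x ≢ ℓ
        ¬B⇒ℓ : ∀ {x} → ¬ A x → ¬ B x → x ≡ ℓ
        ¬B⇒ℓ ¬Ax ¬Bx = decidable-stable (_ ≟ ℓ) (λ x≢ℓ → ¬Bx (¬Ax , x≢ℓ))
        leave′ : ∀ {x y} → Outer.Inside x y → B x → ¬ B y → x ≡ u′ × y ≡ ℓ
        leave′ {x} ((x~y , _) , _ , ¬Ay) _ ¬By with refl ← ¬B⇒ℓ ¬Ay ¬By = ℓ-leaf x (~-sym G′ x~y) , refl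
        enter′ : ∀ {x y} → Outer.Inside x y → ¬ B x → B y → x ≡ ℓ × y ≡ u′
        enter′ {y = y} ((x~y , _) , ¬Ax , _) ¬Bx _ with refl ← ¬B⇒ℓ ¬Ax ¬Bx = refl , ℓ-leaf y x~y
        module Inner = Bridge B (λ x → ¬? (A? x) ×-dec ¬? (x ≟ ℓ)) u′ ℓ leave′ enter′

        ¬ℓu′ : ∀ {a b} → a ≢ ℓ → b ≢ ℓ → ¬ SamePair a b ℓ u′
        ¬ℓu′ a≢ℓ _   (inj₁ (a≡ℓ , _)) = a≢ℓ a≡ℓ
        ¬ℓu′ _   b≢ℓ (inj₂ (_ , b≡ℓ)) = b≢ℓ b≡ℓ
        ¬uw : ∀ {a b} → ¬ A a → ¬ A b → ¬ SamePair a b u w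
        ¬uw _   ¬Ab (inj₁ (_ , refl)) = ¬Ab w∈A
        ¬uw ¬Aa _   (inj₂ (refl , _)) = ¬Aa w∈A
        back : ∀ {a b} → Inner.Inside a b → OtherEdge G p q a b
        back (((a~b , ¬pq) , ¬Aa , ¬Ab) , (_ , a≢ℓ) , (_ , b≢ℓ)) = old-edge a~b (¬ℓu′ a≢ℓ b≢ℓ) (¬uw ¬Aa ¬Ab) , ¬pq

    acyclic′ : Acyclic G′
    acyclic′ p q p~q D with A? p | A? q
    ... | yes Ap | yes Aq = inside⇒¬Detour p~q Ap Aq D
    ... | yes Ap | no ¬Aq = crossing⇒¬Detour p~q Ap ¬Aq D
    ... | no ¬Ap | yes Aq = crossing⇒¬Detour (~-sym G′ p~q) Aq ¬Ap (Detour-sym G′ D)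
    ... | no ¬Ap | no ¬Aq with p ≟ ℓ | q ≟ ℓ
    ...   | yes p≡ℓ | _       = pendant⇒¬Detour G′ ℓ-leaf p~q (inj₁ p≡ℓ) D
    ...   | no _    | yes q≡ℓ = pendant⇒¬Detour G′ ℓ-leaf p~q (inj₂ q≡ℓ) D
    ...   | no p≢ℓ | no q≢ℓ = outside⇒¬Detour p~q ¬Ap ¬Aq p≢ℓ q≢ℓ D

-- Forest classes are connected

module _ {n : ℕ} where

  prefix-avoiding : (G : Graph n) {e z : Fin n} → ∀ {a b} (W : Walk (_~[ G ]_) a b) →
                    All (e ≢_) (vertices W) → z ∈ vertices W → Walk (OtherEdge G e z) a z
  prefix-avoiding G []                _              (here refl) = []
  prefix-avoiding G (_ ∷ _)           _              (here refl) = []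
  prefix-avoiding G {e} {z} (_∷_ {y = y} x~y W) (e≢x ∷ e∉W) (there z∈W) = (x~y , ¬ez) ∷ prefix-avoiding G W e∉W z∈W
    where
    ¬ez : ¬ SamePair _ y e z
    ¬ez (inj₁ (x≡e , _)) = e≢x (sym x≡e)
    ¬ez (inj₂ (_ , y≡e)) = All-vertices-head W e∉W (sym y≡e)

  another-neighbour : (G : Graph n) {e p : Fin n} → e ~[ G ] p → degree G e ≢ 1 → ∃ λ z → z ≢ p × e ~[ G ] z
  another-neighbour G {e} {p} e~p deg≢1 with count (unset (Adj G e) p) in others
  ... | zero  = contradiction (trans (degree≡count G e) (trans (count-unset (Adj G e) p e~p) (cong suc others))) deg≢1
  ... | suc _ = map₂ (unset-true (Adj G e)) (count>0⇒∃ (unset (Adj G e) p) (subst (0 <_) (sym others) (s≤s z≤n)))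

  -- The end of a maximal path is a leaf.
  leaf-exists : (G : Graph n) → Acyclic G → ∀ {a b} → a ~[ G ] b → ∃ λ ℓ → degree G ℓ ≡ 1
  leaf-exists G acyclic {a} {b} a~b =
    grow n (~-sym G a~b) [] ((adjacent⇒≢ G a~b ∘ sym ∷ []) ∷ [] ∷ []) (m<m+n n (s≤s z≤n))
    where
    open import Data.List.Membership.DecPropositional (_≟_ {n}) using (_∈?_)
    grow : ∀ k {e p x} → e ~[ G ] p → (W : Walk (_~[ G ]_) p x) → Unique (e ∷ vertices W) →
           n < k + length (e ∷ vertices W) → ∃ λ ℓ → degree G ℓ ≡ 1
    grow zero    _ W unique bound = ⊥-elim (<⇒≱ bound (Unique⇒length≤n unique))
    grow (suc k) {e} {p} e~p W unique@(e∉W ∷ _) bound with degree G e ≟ℕ 1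
    ... | yes deg≡1 = e , deg≡1
    ... | no  deg≢1 with z , z≢p , e~z ← another-neighbour G e~p deg≢1 | z ∈? vertices W
    ...   | yes z∈W = ⊥-elim (acyclic e z e~z ((e~p , ¬ez) ∷ prefix-avoiding G W e∉W z∈W))
      where
      ¬ez : ¬ SamePair e p e z
      ¬ez (inj₁ (_ , p≡z)) = z≢p (sym p≡z)
      ¬ez (inj₂ (e≡z , _)) = adjacent⇒≢ G e~z e≡z
    ...   | no  z∉W = grow k (~-sym G e~z) (e~p ∷ W)
                        ((adjacent⇒≢ G e~z ∘ sym ∷ ¬Any⇒All¬ (vertices W) z∉W) ∷ unique)
                        (subst (n <_) (sym (+-suc k _)) bound)

  unreachable-neighbour : (G : Graph n) → Acyclic G → ∀ a b → 2 ≤ degree G b →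
                          ∃ λ w → b ~[ G ] w × ¬ Walk (EdgeAvoiding G b) a w
  unreachable-neighbour G acyclic a b 2≤deg
    with w₁ , w₂ , w₁≢w₂ , b~w₁ , b~w₂ ← count≥2⇒∃₂ (Adj G b) (subst (2 ≤_) (degree≡count G b) 2≤deg)
    with Walk? (EdgeAvoiding? G b) a w₁ | Walk? (EdgeAvoiding? G b) a w₂
  ... | no ¬W₁ | _      = w₁ , b~w₁ , ¬W₁
  ... | yes _  | no ¬W₂ = w₂ , b~w₂ , ¬W₂
  ... | yes W₁ | yes W₂ =
    ⊥-elim (acyclic b w₁ b~w₁ ((b~w₂ , ¬bw₁) ∷ mapʷ other (reverseʷ (EdgeAvoiding-sym G) W₂ ++ʷ W₁)))
    where
    ¬bw₁ : ¬ SamePair b w₂ b w₁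
    ¬bw₁ (inj₁ (_ , w₂≡w₁)) = w₁≢w₂ (sym w₂≡w₁)
    ¬bw₁ (inj₂ (b≡w₁ , _))  = adjacent⇒≢ G b~w₁ b≡w₁
    other : ∀ {x y} → EdgeAvoiding G b x y → OtherEdge G b w₁ x y
    other (x~y , x≢b , y≢b) = x~y , λ { (inj₁ (x≡b , _)) → x≢b x≡b ; (inj₂ (_ , y≡b)) → y≢b y≡b }

module Forests {n : ℕ} = Peeling {n} Acyclic (λ N → count N ≡ 1) Acyclic-isolate Acyclic-attach

module _ {n : ℕ} where
  open Forests {n}

  record Reattached (d : Fin n → ℕ) (G : Graph n) (ℓ v : Fin n) : Set where
    field
      graph    : Graph n
      G⇝graph  : SwitchChain (Class d) G graph
      in-class : Class d graph
      ℓ~v      : ℓ ~[ graph ] v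

  reattach : ∀ {d} G → Class d G → ∀ ℓ u u′ w → ℓ ~[ G ] u → (∀ t → ℓ ~[ G ] t → t ≡ u) →
             u′ ~[ G ] w → u ≢ u′ → ¬ Walk (EdgeAvoiding G u′) u w → Reattached d G ℓ u′
  reattach G (dG , acyclic) ℓ u u′ w ℓ~u leaf u′~w u≢u′ separated = record
    { graph    = G′
    ; G⇝graph  = step (ℓ , u , u′ , w , C , S)
    ; in-class = (λ i → trans (switch-preserves-degree C S i) (dG i)) , acyclic′
    ; ℓ~v      = ℓ~u′
    }
    where open LeafSwitch G acyclic ℓ u u′ w ℓ~u leaf u′~w u≢u′ separated

  degree≡1⇒unique : (G : Graph n) (ℓ : Fin n) {a : Fin n} → degree G ℓ ≡ 1 → ℓ ~[ G ] a → ∀ t → ℓ ~[ G ] t → t ≡ a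
  degree≡1⇒unique G ℓ deg≡1 ℓ~a t ℓ~t = count≡1⇒unique (Adj G ℓ) (trans (sym (degree≡count G ℓ)) deg≡1) ℓ~a ℓ~t

  aligned-at-leaf : ∀ {d G H G′ H′ ℓ v} → d ℓ ≡ 1 → SwitchChain (Class d) G G′ → SwitchChain (Class d) H H′ →
                    Class d G′ → Class d H′ → ℓ ~[ G′ ] v → ℓ ~[ H′ ] v → Aligned d G H
  aligned-at-leaf {d} {G′ = G′} {H′} {ℓ} {v} dℓ≡1 G⇝G′ H⇝H′ cG′@(dG′ , _) cH′@(dH′ , _) G′-ℓ~v H′-ℓ~v = record
    { w = ℓ ; w-active = cong positive dℓ≡1 ; G′ = G′ ; H′ = H′ ; G⇝G′ = G⇝G′ ; H⇝H′ = H⇝H′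
    ; G′∈Class = cG′ ; H′∈Class = cH′ ; same-row = same-row
    ; good-row = trans (sym (degree≡count G′ ℓ)) (trans (dG′ ℓ) dℓ≡1) }
    where
    same-row : ∀ y → Adj G′ ℓ y ≡ Adj H′ ℓ y
    same-row y with Adj G′ ℓ y in G′-ℓy | Adj H′ ℓ y in H′-ℓy
    ... | true  | true  = refl
    ... | false | false = refl
    ... | true  | false with refl ← degree≡1⇒unique G′ ℓ (trans (dG′ ℓ) dℓ≡1) G′-ℓ~v y G′-ℓy =
      contradiction H′-ℓ~v (not-¬ H′-ℓy)
    ... | false | true  with refl ← degree≡1⇒unique H′ ℓ (trans (dH′ ℓ) dℓ≡1) H′-ℓ~v y H′-ℓy =
      contradiction G′-ℓ~v (not-¬ G′-ℓy)

  adjacent⇒degree>0 : (G : Graph n) {x y : Fin n} → x ~[ G ] y → 0 < degree G x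
  adjacent⇒degree>0 G {x} {y} x~y = subst (0 <_) (sym (trans (degree≡count G x) (count-unset (Adj G x) y x~y))) (s≤s z≤n)

  ≤1⇒≡1 : ∀ {a} → ¬ 2 ≤ a → 0 < a → a ≡ 1
  ≤1⇒≡1 {suc zero}    _   _ = refl
  ≤1⇒≡1 {suc (suc a)} ¬2≤ _ = ⊥-elim (¬2≤ (s≤s (s≤s z≤n)))

  -- Pick a leaf ℓ of H; if its neighbours u in G and u′ in H differ, a LeafSwitch moves ℓ over in one of them.
  align-forest : ∀ d G H → Class d G → Class d H → ∀ w → positive (d w) ≡ true → Aligned d G H
  align-forest d G H cG@(dG , acyclicG) cH@(dH , acyclicH) w₀ w₀-active = by-cases (u ≟ u′) (2 ≤? d u′) (2 ≤? d u)
    where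
    leaf-of-H = leaf-exists H acyclicH (proj₂ (degree>0⇒∃ H w₀ (subst (0 <_) (sym (dH w₀)) (positive⇒>0 w₀-active))))
    ℓ = proj₁ leaf-of-H
    dℓ≡1 : d ℓ ≡ 1
    dℓ≡1 = trans (sym (dH ℓ)) (proj₂ leaf-of-H)
    ℓ-in-G = degree>0⇒∃ G ℓ (subst (0 <_) (sym (trans (dG ℓ) dℓ≡1)) (s≤s z≤n))
    ℓ-in-H = degree>0⇒∃ H ℓ (subst (0 <_) (sym (proj₂ leaf-of-H)) (s≤s z≤n))
    u  = proj₁ ℓ-in-G
    u′ = proj₁ ℓ-in-H
    G-ℓ~u  = proj₂ ℓ-in-G
    H-ℓ~u′ = proj₂ ℓ-in-H
    G-leaf = degree≡1⇒unique G ℓ (trans (dG ℓ) dℓ≡1) G-ℓ~u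
    H-leaf = degree≡1⇒unique H ℓ (trans (dH ℓ) dℓ≡1) H-ℓ~u′

    d≡1 : ∀ K → HasDegrees d K → ∀ {x y} → x ~[ K ] y → ¬ 2 ≤ d x → d x ≡ 1
    d≡1 K dK {x} x~y ¬2≤ = ≤1⇒≡1 ¬2≤ (subst (0 <_) (dK x) (adjacent⇒degree>0 K x~y))

    -- If u and u′ both have degree 1, then ℓu is a component of G, so u′ and its neighbour lie outside it.
    both-leaves : u ≢ u′ → ¬ 2 ≤ d u′ → ¬ 2 ≤ d u → Aligned d G H
    both-leaves u≢u′ ¬2≤u′ ¬2≤u =
      aligned-at-leaf dℓ≡1 G⇝graph done in-class cH ℓ~v H-ℓ~u′
      where
      u-leaf = degree≡1⇒unique G u (trans (dG u) (d≡1 G dG (~-sym G G-ℓ~u) ¬2≤u)) (~-sym G G-ℓ~u)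
      u′-in-G = degree>0⇒∃ G u′ (subst (0 <_) (sym (trans (dG u′) (d≡1 H dH (~-sym H H-ℓ~u′) ¬2≤u′))) (s≤s z≤n))
      w = proj₁ u′-in-G
      stays : ∀ {x y} → Walk (EdgeAvoiding G u′) x y → x ≡ u ⊎ x ≡ ℓ → y ≡ u ⊎ y ≡ ℓ
      stays []                            x∈ = x∈
      stays (_∷_ {y = z} (u~z , _) W) (inj₁ refl) = stays W (inj₂ (u-leaf z u~z))
      stays (_∷_ {y = z} (ℓ~z , _) W) (inj₂ refl) = stays W (inj₁ (G-leaf z ℓ~z))
      w∉ : ∀ {y} → y ≡ u ⊎ y ≡ ℓ → ¬ u′ ~[ G ] y
      w∉ (inj₁ refl) u′~u = adjacent⇒≢ H H-ℓ~u′ (sym (u-leaf u′ (~-sym G u′~u)))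
      w∉ (inj₂ refl) u′~ℓ = u≢u′ (sym (G-leaf u′ (~-sym G u′~ℓ)))
      open Reattached (reattach G cG ℓ u u′ w G-ℓ~u G-leaf (proj₂ u′-in-G) u≢u′
                         (λ W → w∉ (stays W (inj₁ refl)) (proj₂ u′-in-G)))

    by-cases : Dec (u ≡ u′) → Dec (2 ≤ d u′) → Dec (2 ≤ d u) → Aligned d G H
    by-cases (yes u≡u′) _ _ = aligned-at-leaf dℓ≡1 done done cG cH G-ℓ~u (subst (ℓ ~[ H ]_) (sym u≡u′) H-ℓ~u′)
    by-cases (no u≢u′) (yes 2≤u′) _ =
      let w , u′~w , separated = unreachable-neighbour G acyclicG u u′ (subst (2 ≤_) (sym (dG u′)) 2≤u′)
          open Reattached (reattach G cG ℓ u u′ w G-ℓ~u G-leaf u′~w u≢u′ separated)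
      in aligned-at-leaf dℓ≡1 G⇝graph done in-class cH ℓ~v H-ℓ~u′
    by-cases (no u≢u′) (no _) (yes 2≤u) =
      let w , u~w , separated = unreachable-neighbour H acyclicH u′ u (subst (2 ≤_) (sym (dH u)) 2≤u)
          open Reattached (reattach H cH ℓ u′ u w H-ℓ~u′ H-leaf u~w (u≢u′ ∘ sym) separated)
      in aligned-at-leaf dℓ≡1 done G⇝graph cG in-class G-ℓ~u ℓ~v
    by-cases (no u≢u′) (no ¬2≤u′) (no ¬2≤u) = both-leaves u≢u′ ¬2≤u′ ¬2≤u

  forest-class-connected : (d : Fin n → ℕ) (G H : Graph n) → Class d G → Class d H → SwitchChain (Class d) G H
  forest-class-connected = connected align-forest

SwitchChain-map : {P Q : Graph n → Set} → (∀ K → P K → Q K) → ∀ {G H} → SwitchChain P G H → SwitchChain Q G H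
SwitchChain-map P⇒Q done          = done
SwitchChain-map P⇒Q (step s)      = step s
SwitchChain-map P⇒Q (reverse c)   = reverse (SwitchChain-map P⇒Q c)
SwitchChain-map P⇒Q (via c pK c′) = via (SwitchChain-map P⇒Q c) (P⇒Q _ pK) (SwitchChain-map P⇒Q c′)

InG⇒HasDegrees : (s : Vec ℕ n) (K : Graph n) → InG s K → HasDegrees (lookup s) K
InG⇒HasDegrees s K refl i = sym (lookup∘tabulate (degree K) i)

HasDegrees⇒InG : (s : Vec ℕ n) (K : Graph n) → HasDegrees (lookup s) K → InG s K
HasDegrees⇒InG s K dK = trans (tabulate-cong dK) (tabulate∘lookup s)

InG-connected : (s : Vec ℕ n) (G H : Graph n) → InG s G → InG s H → SwitchChain (InG s) G H
InG-connected s G H G∈ H∈ =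
  SwitchChain-map (λ K (dK , _) → HasDegrees⇒InG s K dK)
    (degree-class-connected (lookup s) G H (InG⇒HasDegrees s G G∈) (InG⇒HasDegrees s H H∈))

InF-connected : (s : Vec ℕ n) (G H : Graph n) → InF s G → InF s H → SwitchChain (InF s) G H
InF-connected s G H (G∈ , G-forest) (H∈ , H-forest) =
  SwitchChain-map (λ K (dK , acyclic) → HasDegrees⇒InG s K dK , Acyclic⇒IsForest acyclic)
    (forest-class-connected (lookup s) G H (InG⇒HasDegrees s G G∈ , IsForest⇒Acyclic G-forest)
                                           (InG⇒HasDegrees s H H∈ , IsForest⇒Acyclic H-forest))

theorem8 : ∀ {n} (s : Vec ℕ n) → Graphical s → (ξ : GraphParameter) →
    StableUnder2Switch ξ →
    IntervalProperty ξ (InG s) × IntervalProperty ξ (InF s)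
theorem8 s _ ξ stable =
  switch-connected⇒IntervalProperty ξ stable (InG-connected s) ,
  switch-connected⇒IntervalProperty ξ stable (InF-connected s)
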